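{- Let $k\ge2$ and $n$ be positive integers and let $A$ be a generalized Cartan matrix of type $N_{k,n}$. Then every principal submatrix of $A$ of type $N_{k-1}$ has dimension at least $n-1$.
   Context: A generalized Cartan matrix (GCM) is an $\ell\times\ell$ integer matrix $A=(a_{ij})$ with $a_{ii}=2$, $a_{ij}\le 0$ for $i\neq j$, and $a_{ij}=0$ if and only if $a_{ji}=0$; its dimension is $\ell$. A principal submatrix is obtained by deleting some rows and the columns with the same indices. GCMs are assumed symmetrizable (some invertible diagonal $D$ makes $DA$ symmetric) and indecomposable (not block diagonal after a simultaneous permutation of rows and columns). Vector inequalities are entrywise. An indecomposable GCM is of finite type if $\det A\neq0$, there is $u>0$ with $Au>0$, and $Au\ge0$ implies $u>0$ or $u=0$; of affine type if $\operatorname{corank}A=1$, there is $u>0$ with $Au=0$, and $Au\ge0$ implies $Au=0$. It is hyperbolic if it is neither finite nor affine but every proper indecomposable principal submatrix is finite or affine. Type $N_0$ = finite, $N_1$ = affine, $N_2$ = hyperbolic; for $k\ge3$, a GCM is of type $N_k$ if it contains at least one principal submatrix of type $N_{k-1}$ and every other (indecomposable) principal submatrix is of type $N_m$ for some $m<k$. Type $N_{k,n}$ means type $N_k$ and dimension $n$.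
   Formalization: The vectors u in the definitions of finite and affine type, the diagonal matrix D making DA symmetric, and the kernel in the corank condition are taken over the rationals. -}

module Defs where

open import Data.Nat as ℕ using (ℕ; zero; suc)
open import Data.Integer as ℤ using (ℤ)
open import Data.Rational as ℚ using (ℚ; 0ℚ)
open import Data.Fin using (Fin; zero; suc; punchIn)
open import Data.Bool using (Bool; true; false)
open import Data.Product using (Σ; ∃; ∃-syntax; _×_; _,_)
open import Data.Sum using (_⊎_)
open import Relation.Nullary using (¬_)
open import Relation.Binary.PropositionalEquality using (_≡_; _≢_)
open import Function.Definitions using (Injective)

Mat : ℕ → Set
Mat n = Fin n → Fin n → ℤ

-- Real-valued vectors are replaced by rational vectors.
Vecℚ : ℕ → Set
Vecℚ n = Fin n → ℚ

sumℤ : ∀ {n} → (Fin n → ℤ) → ℤ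
sumℤ {zero} f = ℤ.0ℤ
sumℤ {suc n} f = f zero ℤ.+ sumℤ (λ i → f (suc i))

sumℚ : ∀ {n} → (Fin n → ℚ) → ℚ
sumℚ {zero} f = 0ℚ
sumℚ {suc n} f = f zero ℚ.+ sumℚ (λ i → f (suc i))

sign : ∀ {n} → Fin n → ℤ
sign zero = ℤ.1ℤ
sign (suc j) = ℤ.- sign j

det : ∀ {n} → Mat n → ℤ
det {zero} M = ℤ.1ℤ
det {suc n} M = sumℤ (λ j → sign j ℤ.* (M zero j ℤ.* det (λ i' j' → M (suc i') (punchIn j j'))))

toℚ : ℤ → ℚ
toℚ z = z ℚ./ 1

_·_ : ∀ {n} → Mat n → Vecℚ n → Vecℚ n
(A · u) i = sumℚ (λ j → toℚ (A i j) ℚ.* u j)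

Pos : ∀ {n} → Vecℚ n → Set
Pos u = ∀ i → 0ℚ ℚ.< u i

NonNeg : ∀ {n} → Vecℚ n → Set
NonNeg u = ∀ i → 0ℚ ℚ.≤ u i

IsZero : ∀ {n} → Vecℚ n → Set
IsZero u = ∀ i → u i ≡ 0ℚ

IsGCM : ∀ {n} → Mat n → Set
IsGCM {n} A = (∀ i → A i i ≡ ℤ.+ 2)
            × (∀ i j → i ≢ j → A i j ℤ.≤ ℤ.0ℤ)
            × (∀ i j → A i j ≡ ℤ.0ℤ → A j i ≡ ℤ.0ℤ)

-- some invertible diagonal D = diag(d) makes DA symmetric
Symmetrizable : ∀ {n} → Mat n → Set
Symmetrizable {n} A = Σ (Vecℚ n) λ d → (∀ i → d i ≢ 0ℚ)
                      × (∀ i j → d i ℚ.* toℚ (A i j) ≡ d j ℚ.* toℚ (A j i))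

-- not block diagonal after a simultaneous permutation: there is no splitting
-- of the indices into two nonempty parts S, Sᶜ with A i j = 0 for i ∈ S, j ∉ S
Indecomposable : ∀ {n} → Mat n → Set
Indecomposable {n} A = ¬ (Σ (Fin n → Bool) λ S → (∃ λ i → S i ≡ true) × (∃ λ j → S j ≡ false)
                          × (∀ i j → S i ≡ true → S j ≡ false → A i j ≡ ℤ.0ℤ))

IsSIGCM : ∀ {n} → Mat n → Set
IsSIGCM A = IsGCM A × Symmetrizable A × Indecomposable A

Corank1 : ∀ {n} → Mat n → Set
Corank1 {n} A = Σ (Vecℚ n) λ v → ¬ IsZero v × IsZero (A · v)
                × (∀ w → IsZero (A · w) → ∃ λ c → ∀ i → w i ≡ c ℚ.* v i)

IsFinite : ∀ {n} → Mat n → Set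
IsFinite {n} A = IsSIGCM A × det A ≢ ℤ.0ℤ
               × (Σ (Vecℚ n) λ u → Pos u × Pos (A · u))
               × (∀ u → NonNeg (A · u) → Pos u ⊎ IsZero u)

IsAffine : ∀ {n} → Mat n → Set
IsAffine {n} A = IsSIGCM A × Corank1 A
               × (Σ (Vecℚ n) λ u → Pos u × IsZero (A · u))
               × (∀ u → NonNeg (A · u) → IsZero (A · u))

-- principal submatrix indexed by an injective map Fin m → Fin n
sub : ∀ {n m} → Mat n → (Fin m → Fin n) → Mat m
sub A f i j = A (f i) (f j)

IsHyperbolic : ∀ {n} → Mat n → Set
IsHyperbolic {n} A = IsSIGCM A × ¬ IsFinite A × ¬ IsAffine A
  × (∀ m (f : Fin m → Fin n) → Injective _≡_ _≡_ f → m ℕ.< n →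
       Indecomposable (sub A f) → IsFinite (sub A f) ⊎ IsAffine (sub A f))

TypeN : ℕ → ∀ {n} → Mat n → Set
TypeUpTo : ℕ → ∀ {n} → Mat n → Set

TypeN zero A = IsFinite A
TypeN (suc zero) A = IsAffine A
TypeN (suc (suc zero)) A = IsHyperbolic A
TypeN (suc (suc (suc k))) {n} A = IsSIGCM A
  × (Σ ℕ λ m → Σ (Fin m → Fin n) λ f → Injective _≡_ _≡_ f × m ℕ.< n
       × TypeN (suc (suc k)) (sub A f))
  × (∀ m (f : Fin m → Fin n) → Injective _≡_ _≡_ f → m ℕ.< n →
       Indecomposable (sub A f) → TypeUpTo (suc (suc k)) (sub A f))

TypeUpTo zero A = TypeN zero A
TypeUpTo (suc k) A = TypeN (suc k) A ⊎ TypeUpTo k A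

{-# OPTIONS --safe #-}
-- Call u > 0 with A u ≥ 0 a witness for A, and a strict witness if moreover A u ≠ 0. Restricting a
-- witness of an indecomposable GCM to a proper nonempty set of indices gives a strict witness of the
-- principal submatrix: the dropped entries of A u are ≤ 0 and, by indecomposability, not all zero.
-- A strict witness forces finite type (Vinberg): A v ≥ 0 then implies v > 0 or v = 0, and an induction
-- on Schur complements, with Chiò's condensation for the determinant, gives det A ≠ 0 and some x > 0
-- with A x > 0. Hence finite and affine matrices have only finite proper principal submatrices, types
-- are unique, and passing to a proper indecomposable principal submatrix strictly lowers a positive
-- type. Now if B of type N_{k-1} had dimension m < n - 1 inside A of type N_k, connectedness of A would
-- let us add one index to B and obtain an indecomposable C with B ⊊ C ⊊ A: its type is at most k - 1
-- because C is proper in A, and exceeds k - 1 because C properly contains B.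
module Submission where

open import Defs
open import Data.Nat as ℕ using (ℕ; zero; suc; z≤n; s≤s)
import Data.Nat.Properties as ℕ
open import Data.Integer as ℤ using (ℤ; 0ℤ)
import Data.Integer.Properties as ℤ
open import Data.Fin as Fin using (Fin; zero; suc; punchIn; inject₁; toℕ; fromℕ<)
import Data.Fin.Properties as Fin
open import Data.Vec.Functional using (_∷_)
open import Data.Bool as Bool using (true; false)
open import Data.Bool.Properties using (¬-not)
open import Data.Product using (Σ; ∃; _×_; _,_; proj₁; proj₂)
open import Data.Sum using (_⊎_; inj₁; inj₂; [_,_]′)
open import Data.Empty using (⊥; ⊥-elim)
open import Relation.Nullary using (¬_; Dec; yes; no; does; contradiction)
open import Relation.Nullary.Decidable using (dec-true; dec-false; ¬?; _×-dec_)
open import Relation.Binary.PropositionalEquality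
open import Function.Definitions using (Injective)

ZMatrix : ∀ {n} → Mat n → Set
ZMatrix A = ∀ i j → i ≢ j → A i j ℤ.≤ 0ℤ

ZeroPatternSymmetric : ∀ {n} → Mat n → Set
ZeroPatternSymmetric A = ∀ i j → A i j ≡ 0ℤ → A j i ≡ 0ℤ

Im : ∀ {m n} → (Fin m → Fin n) → Fin n → Set
Im f j = ∃ λ i → f i ≡ j

Im? : ∀ {m n} (f : Fin m → Fin n) j → Dec (Im f j)
Im? f j = Fin.any? (λ i → f i Fin.≟ j)

NoEdgesOut : ∀ {n} → Mat n → (Fin n → Set) → Set
NoEdgesOut A P = ∀ a b → P a → ¬ P b → A a b ≡ 0ℤ

indecomposable⇒¬NoEdgesOut : ∀ {n} {A : Mat n} {P : Fin n → Set} → Indecomposable A →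
  (∀ j → Dec (P j)) → ∀ {i j} → P i → ¬ P j → ¬ NoEdgesOut A P
indecomposable⇒¬NoEdgesOut {A = A} {P} ind P? {i} {j} pi ¬pj noEdges =
  ind ((λ a → does (P? a)) , (i , dec-true (P? i) pi) , (j , dec-false (P? j) ¬pj) , cross)
  where
  cross : ∀ a b → does (P? a) ≡ true → does (P? b) ≡ false → A a b ≡ 0ℤ
  cross a b _ _ with P? a | P? b
  cross a b _ _ | yes pa | no ¬pb = noEdges a b pa ¬pb
  cross a b () _ | no _ | _
  cross a b _ () | yes _ | yes _

notSurjective : ∀ {m n} {f : Fin m → Fin n} → Injective _≡_ _≡_ f → m ℕ.< n → ∃ λ j → ¬ Im f j
notSurjective {m} {n} {f} inj m<n with Fin.all? (Im? f)
... | no ¬surjective = Fin.¬∀⟶∃¬ n (Im f) (Im? f) ¬surjective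
... | yes surjective with Fin.pigeonhole m<n (λ j → proj₁ (surjective j))
...   | j , j′ , j<j′ , same = contradiction
          (trans (sym (proj₂ (surjective j))) (trans (cong f same) (proj₂ (surjective j′))))
          (Fin.<⇒≢ j<j′)

edgeLeavingImage : ∀ {m n} (A : Mat n) → Indecomposable A → {f : Fin m → Fin n} → Injective _≡_ _≡_ f →
  1 ℕ.≤ m → m ℕ.< n → ∃ λ i → ∃ λ j → ¬ Im f j × A (f i) j ≢ 0ℤ
edgeLeavingImage {suc m} A ind {f} inj _ m<n
  with Fin.any? (λ i → Fin.any? (λ j → ¬? (Im? f j) ×-dec ¬? (A (f i) j ℤ.≟ 0ℤ)))
... | yes edge = edge
... | no noEdge = ⊥-elim (indecomposable⇒¬NoEdgesOut ind (Im? f) (zero , refl) (proj₂ (notSurjective inj m<n)) noEdgeOut)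
  where
  noEdgeOut : NoEdgesOut A (Im f)
  noEdgeOut a b (i , refl) ¬imb with A (f i) b ℤ.≟ 0ℤ
  ... | yes zero-entry = zero-entry
  ... | no nonzero = ⊥-elim (noEdge (i , b , ¬imb , nonzero))

∷-injective : ∀ {m n} {f : Fin m → Fin n} {j} → Injective _≡_ _≡_ f → ¬ Im f j → Injective _≡_ _≡_ (j ∷ f)
∷-injective inj ¬imj {zero} {zero} _ = refl
∷-injective inj ¬imj {zero} {suc y} e = contradiction (y , sym e) ¬imj
∷-injective inj ¬imj {suc x} {zero} e = contradiction (x , e) ¬imj
∷-injective inj ¬imj {suc x} {suc y} e = cong suc (inj e)

-- A cut of the enlarged matrix either cuts sub A f or separates j from all of f; A (f i) j ≢ 0 rules out the latter.
∷-indecomposable : ∀ {m n} (A : Mat n) → ZeroPatternSymmetric A → (f : Fin m → Fin n) → Indecomposable (sub A f) →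
  ∀ {i j} → A (f i) j ≢ 0ℤ → Indecomposable (sub A (j ∷ f))
∷-indecomposable A symmetric f indB {i} {j} nonzero (S , (a , Sa) , (b , ¬Sb) , noEdges)
  with Fin.any? (λ k → S (suc k) Bool.≟ true) | Fin.any? (λ k → S (suc k) Bool.≟ false)
... | yes (x , Sx) | yes (y , ¬Sy) = indB ((λ k → S (suc k)) , (x , Sx) , (y , ¬Sy) , λ k l → noEdges (suc k) (suc l))
... | no noneTrue | _ = nonzero (symmetric j (f i) (noEdges zero (suc i) (inS₀ a Sa) (¬-not (λ e → noneTrue (i , e)))))
  where
  inS₀ : ∀ a → S a ≡ true → S zero ≡ true
  inS₀ zero Sa = Sa
  inS₀ (suc a) Sa = contradiction (a , Sa) noneTrue
... | yes _ | no noneFalse = nonzero (noEdges (suc i) zero (¬-not (λ e → noneFalse (i , e))) (outS₀ b ¬Sb))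
  where
  outS₀ : ∀ b → S b ≡ false → S zero ≡ false
  outS₀ zero ¬Sb = ¬Sb
  outS₀ (suc b) ¬Sb = contradiction (b , ¬Sb) noneFalse

extend-indecomposable : ∀ {m n} (A : Mat n) → ZeroPatternSymmetric A → Indecomposable A →
  {f : Fin m → Fin n} → Injective _≡_ _≡_ f → Indecomposable (sub A f) → 1 ℕ.≤ m → m ℕ.< n →
  ∃ λ j → Injective _≡_ _≡_ (j ∷ f) × Indecomposable (sub A (j ∷ f))
extend-indecomposable A symmetric ind {f} inj indB 1≤m m<n with edgeLeavingImage A ind inj 1≤m m<n
... | i , j , j∉f , nonzero = j , ∷-injective inj j∉f , ∷-indecomposable A symmetric f indB nonzero

module Determinant where

  open import Data.Integer using (-1ℤ; _+_; _*_; -_; _-_; _^_)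
  open import Data.Integer.Solver using (module +-*-Solver)
  open +-*-Solver
  open import Algebra.Bundles using (CommutativeRing)
  open import Algebra.Properties.Semiring.Sum (CommutativeRing.semiring ℤ.+-*-commutativeRing)
    using (sum; sum-cong-≗; *-distribˡ-sum; ∑-distrib-+; sum-permute; sum-replicate-zero)
  open import Data.Fin.Permutation using (permutation)
  open import Data.Vec.Functional using (updateAt)
  open import Data.Vec.Functional.Properties using (updateAt-updates; updateAt-minimal; updateAt-id-local)
  open ≡-Reasoning

  sumℤ≡sum : ∀ {n} (f : Fin n → ℤ) → sumℤ f ≡ sum f
  sumℤ≡sum {zero} f = refl
  sumℤ≡sum {suc n} f = cong (f zero +_) (sumℤ≡sum (λ i → f (suc i)))

  sum-neg : ∀ {n} (f : Fin n → ℤ) → sum (λ l → - f l) ≡ - sum f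
  sum-neg f = begin
    sum (λ l → - f l)      ≡⟨ sum-cong-≗ (λ l → sym (ℤ.-1*i≡-i (f l))) ⟩
    sum (λ l → -1ℤ * f l)  ≡⟨ sym (*-distribˡ-sum -1ℤ f) ⟩
    -1ℤ * sum f            ≡⟨ ℤ.-1*i≡-i (sum f) ⟩
    - sum f                ∎

  minor : ∀ {n} → Mat (suc n) → Fin (suc n) → Mat n
  minor M l r c = M (suc r) (punchIn l c)

  laplaceTerm : ∀ {n} → Mat (suc n) → Fin (suc n) → ℤ
  laplaceTerm M l = sign l * (M zero l * det (minor M l))

  det≡sum-laplaceTerm : ∀ {n} (M : Mat (suc n)) → det M ≡ sum (laplaceTerm M)
  det≡sum-laplaceTerm M = sumℤ≡sum (laplaceTerm M)

  det-cong : ∀ {n} {M N : Mat n} → (∀ r c → M r c ≡ N r c) → det M ≡ det N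
  det-cong {zero} _ = refl
  det-cong {suc n} {M} {N} M≗N =
    trans (det≡sum-laplaceTerm M) (trans (sum-cong-≗ term≗) (sym (det≡sum-laplaceTerm N)))
    where
    term≗ : ∀ l → laplaceTerm M l ≡ laplaceTerm N l
    term≗ l = cong₂ (λ x d → sign l * (x * d)) (M≗N zero l) (det-cong (λ r c → M≗N (suc r) (punchIn l c)))

  infixl 5 _[_]≔_
  _[_]≔_ : ∀ {n} → Mat n → Fin n → (Fin n → ℤ) → Mat n
  (M [ c ]≔ v) r = updateAt (M r) c (λ _ → v r)

  ≔-here : ∀ {n} (M : Mat n) c v r → (M [ c ]≔ v) r c ≡ v r
  ≔-here M c v r = updateAt-updates c (M r)

  ≔-elsewhere : ∀ {n} (M : Mat n) {c c′} v r → c′ ≢ c → (M [ c ]≔ v) r c′ ≡ M r c′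
  ≔-elsewhere M {c} {c′} v r c′≢c = updateAt-minimal c′ c (M r) c′≢c

  laplaceTerm-≔-here : ∀ {n} (M : Mat (suc n)) c v →
    laplaceTerm (M [ c ]≔ v) c ≡ sign c * (v zero * det (minor M c))
  laplaceTerm-≔-here M c v = cong₂ (λ x d → sign c * (x * d)) (≔-here M c v zero)
    (det-cong (λ r c′ → ≔-elsewhere M v (suc r) (Fin.punchInᵢ≢i c c′)))

  laplaceTerm-≔-elsewhere : ∀ {n} (M : Mat (suc n)) {l c} v (l≢c : l ≢ c) →
    laplaceTerm (M [ c ]≔ v) l ≡ sign l * (M zero l * det (minor M l [ Fin.punchOut l≢c ]≔ (λ r → v (suc r))))
  laplaceTerm-≔-elsewhere M {l} {c} v l≢c =
    cong₂ (λ x d → sign l * (x * d)) (≔-elsewhere M v zero l≢c) (det-cong minor≗)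
    where
    c′ = Fin.punchOut l≢c
    minor≗ : ∀ r k → minor (M [ c ]≔ v) l r k ≡ (minor M l [ c′ ]≔ (λ r → v (suc r))) r k
    minor≗ r k with k Fin.≟ c′
    ... | yes refl = trans (cong ((M [ c ]≔ v) (suc r)) (Fin.punchIn-punchOut l≢c))
                       (trans (≔-here M c v (suc r)) (sym (≔-here (minor M l) c′ (λ r → v (suc r)) r)))
    ... | no k≢c′ =
      trans (≔-elsewhere M v (suc r) punchIn≢c) (sym (≔-elsewhere (minor M l) (λ r → v (suc r)) r k≢c′))
      where
      punchIn≢c : punchIn l k ≢ c
      punchIn≢c e = k≢c′ (Fin.punchIn-injective l k c′ (trans e (sym (Fin.punchIn-punchOut l≢c))))

  laplaceTerm-≔-here-linear : ∀ {n} (M : Mat (suc n)) c (a b : ℤ) (v w : Fin (suc n) → ℤ) →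
    laplaceTerm (M [ c ]≔ (λ r → a * v r + b * w r)) c ≡ a * laplaceTerm (M [ c ]≔ v) c + b * laplaceTerm (M [ c ]≔ w) c
  laplaceTerm-≔-here-linear M c a b v w = begin
    laplaceTerm (M [ c ]≔ (λ r → a * v r + b * w r)) c
      ≡⟨ laplaceTerm-≔-here M c (λ r → a * v r + b * w r) ⟩
    sign c * ((a * v zero + b * w zero) * d)
      ≡⟨ solve 6 (λ s a b x y d → s :* ((a :* x :+ b :* y) :* d) := a :* (s :* (x :* d)) :+ b :* (s :* (y :* d)))
           refl (sign c) a b (v zero) (w zero) d ⟩
    a * (sign c * (v zero * d)) + b * (sign c * (w zero * d))
      ≡⟨ sym (cong₂ (λ x y → a * x + b * y) (laplaceTerm-≔-here M c v) (laplaceTerm-≔-here M c w)) ⟩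
    a * laplaceTerm (M [ c ]≔ v) c + b * laplaceTerm (M [ c ]≔ w) c ∎
    where
    d = det (minor M c)

  det-linear-column : ∀ {n} (M : Mat n) (c : Fin n) (a b : ℤ) (v w : Fin n → ℤ) →
    det (M [ c ]≔ (λ r → a * v r + b * w r)) ≡ a * det (M [ c ]≔ v) + b * det (M [ c ]≔ w)
  det-linear-column {suc n} M c a b v w = begin
    det P
      ≡⟨ det≡sum-laplaceTerm P ⟩
    sum (laplaceTerm P)
      ≡⟨ sum-cong-≗ term ⟩
    sum (λ l → a * laplaceTerm Mv l + b * laplaceTerm Mw l)
      ≡⟨ ∑-distrib-+ (λ l → a * laplaceTerm Mv l) (λ l → b * laplaceTerm Mw l) ⟩
    sum (λ l → a * laplaceTerm Mv l) + sum (λ l → b * laplaceTerm Mw l)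
      ≡⟨ sym (cong₂ _+_ (*-distribˡ-sum a (laplaceTerm Mv)) (*-distribˡ-sum b (laplaceTerm Mw))) ⟩
    a * sum (laplaceTerm Mv) + b * sum (laplaceTerm Mw)
      ≡⟨ sym (cong₂ (λ x y → a * x + b * y) (det≡sum-laplaceTerm Mv) (det≡sum-laplaceTerm Mw)) ⟩
    a * det Mv + b * det Mw ∎
    where
    P = M [ c ]≔ (λ r → a * v r + b * w r)
    Mv = M [ c ]≔ v
    Mw = M [ c ]≔ w
    term : ∀ l → laplaceTerm P l ≡ a * laplaceTerm Mv l + b * laplaceTerm Mw l
    term l with l Fin.≟ c
    ... | yes refl = laplaceTerm-≔-here-linear M l a b v w
    ... | no l≢c = begin
      laplaceTerm P l
        ≡⟨ laplaceTerm-≔-elsewhere M (λ r → a * v r + b * w r) l≢c ⟩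
      sign l * (M zero l * det (minor M l [ c′ ]≔ (λ r → a * v (suc r) + b * w (suc r))))
        ≡⟨ cong (λ d → sign l * (M zero l * d))
             (det-linear-column (minor M l) c′ a b (λ r → v (suc r)) (λ r → w (suc r))) ⟩
      sign l * (M zero l * (a * dv + b * dw))
        ≡⟨ solve 6 (λ s x a b y z → s :* (x :* (a :* y :+ b :* z)) := a :* (s :* (x :* y)) :+ b :* (s :* (x :* z)))
             refl (sign l) (M zero l) a b dv dw ⟩
      a * (sign l * (M zero l * dv)) + b * (sign l * (M zero l * dw))
        ≡⟨ sym (cong₂ (λ x y → a * x + b * y)
             (laplaceTerm-≔-elsewhere M v l≢c) (laplaceTerm-≔-elsewhere M w l≢c)) ⟩
      a * laplaceTerm Mv l + b * laplaceTerm Mw l ∎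
      where
      c′ = Fin.punchOut l≢c
      dv = det (minor M l [ c′ ]≔ (λ r → v (suc r)))
      dw = det (minor M l [ c′ ]≔ (λ r → w (suc r)))

  swap : ∀ {n} → Fin n → Fin (suc n) → Fin (suc n)
  swap zero zero = suc zero
  swap zero (suc zero) = zero
  swap zero (suc (suc k)) = suc (suc k)
  swap (suc i) zero = zero
  swap (suc i) (suc k) = suc (swap i k)

  swap-involutive : ∀ {n} (i : Fin n) k → swap i (swap i k) ≡ k
  swap-involutive zero zero = refl
  swap-involutive zero (suc zero) = refl
  swap-involutive zero (suc (suc k)) = refl
  swap-involutive (suc i) zero = refl
  swap-involutive (suc i) (suc k) = cong suc (swap-involutive i k)

  swap-inject₁ : ∀ {n} (i : Fin n) → swap i (inject₁ i) ≡ suc i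
  swap-inject₁ zero = refl
  swap-inject₁ (suc i) = cong suc (swap-inject₁ i)

  swap-punchIn : ∀ {n} (i : Fin (suc n)) (l : Fin (suc (suc n))) →
      (sign l ≡ - sign (swap i l) × (∀ c → swap i (punchIn l c) ≡ punchIn (swap i l) c))
    ⊎ (swap i l ≡ l × ∃ λ (i′ : Fin n) → ∀ c → swap i (punchIn l c) ≡ punchIn l (swap i′ c))
  swap-punchIn zero zero = inj₁ (refl , λ { zero → refl ; (suc c) → refl })
  swap-punchIn zero (suc zero) = inj₁ (refl , λ { zero → refl ; (suc c) → refl })
  swap-punchIn {zero} zero (suc (suc ()))
  swap-punchIn {suc n} zero (suc (suc l)) =
    inj₂ (refl , zero , λ { zero → refl ; (suc zero) → refl ; (suc (suc c)) → refl })
  swap-punchIn {suc n} (suc i) zero = inj₂ (refl , i , λ c → refl)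
  swap-punchIn {suc n} (suc i) (suc l) with swap-punchIn i l
  ... | inj₁ (sign≡ , commute) = inj₁ (cong -_ sign≡ , λ { zero → refl ; (suc c) → cong suc (commute c) })
  ... | inj₂ (fixed , i′ , commute) =
    inj₂ (cong suc fixed , suc i′ , λ { zero → refl ; (suc c) → cong suc (commute c) })

  det-swap : ∀ {n} (M : Mat (suc n)) (i : Fin n) → det (λ r c → M r (swap i c)) ≡ - det M
  det-swap {suc n} M i = begin
    det N                                   ≡⟨ det≡sum-laplaceTerm N ⟩
    sum (laplaceTerm N)                     ≡⟨ sum-cong-≗ term ⟩
    sum (λ l → - laplaceTerm M (swap i l))  ≡⟨ sum-neg (λ l → laplaceTerm M (swap i l)) ⟩
    - sum (λ l → laplaceTerm M (swap i l))  ≡⟨ cong -_ (sym (sum-permute (laplaceTerm M) swapᵖ)) ⟩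
    - sum (laplaceTerm M)                   ≡⟨ cong -_ (sym (det≡sum-laplaceTerm M)) ⟩
    - det M                                 ∎
    where
    N : Mat (suc (suc n))
    N r c = M r (swap i c)
    swapᵖ = permutation (swap i) (swap i) (swap-involutive i) (swap-involutive i)
    term : ∀ l → laplaceTerm N l ≡ - laplaceTerm M (swap i l)
    term l with swap-punchIn i l
    ... | inj₁ (sign≡ , commute) = begin
      sign l * (M zero (swap i l) * det (minor N l))
        ≡⟨ cong₂ (λ s d → s * (M zero (swap i l) * d)) sign≡ (det-cong (λ r c → cong (M (suc r)) (commute c))) ⟩
      - sign (swap i l) * (M zero (swap i l) * det (minor M (swap i l)))
        ≡⟨ sym (ℤ.neg-distribˡ-* (sign (swap i l)) _) ⟩
      - laplaceTerm M (swap i l) ∎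
    ... | inj₂ (fixed , i′ , commute) = begin
      sign l * (M zero (swap i l) * det (minor N l))
        ≡⟨ cong₂ (λ x d → sign l * (x * d)) (cong (M zero) fixed)
             (trans (det-cong (λ r c → cong (M (suc r)) (commute c))) (det-swap (minor M l) i′)) ⟩
      sign l * (M zero l * - det (minor M l))
        ≡⟨ solve 3 (λ s x d → s :* (x :* (:- d)) := :- (s :* (x :* d))) refl (sign l) (M zero l) (det (minor M l)) ⟩
      - laplaceTerm M l
        ≡⟨ cong (λ k → - laplaceTerm M k) (sym fixed) ⟩
      - laplaceTerm M (swap i l) ∎

  x≡-x⇒x≡0 : ∀ {x} → x ≡ - x → x ≡ 0ℤ
  x≡-x⇒x≡0 {ℤ.+ zero} _ = refl
  x≡-x⇒x≡0 {ℤ.+[1+ n ]} ()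
  x≡-x⇒x≡0 { ℤ.-[1+ n ]} ()

  det-equal-columns : ∀ {n} (M : Mat (suc n)) (c : Fin n) → (∀ r → M r zero ≡ M r (suc c)) → det M ≡ 0ℤ
  det-equal-columns {n} M c = go (toℕ c) M c refl
    where
    -- Recursion on toℕ c: the swap moves the copy of column 0 to suc (inject₁ c), not structurally smaller.
    go : ∀ k (M : Mat (suc n)) (c : Fin n) → toℕ c ≡ k → (∀ r → M r zero ≡ M r (suc c)) → det M ≡ 0ℤ
    go _ M zero _ same = x≡-x⇒x≡0 (trans (sym (det-cong swapped≗M)) (det-swap M zero))
      where
      swapped≗M : ∀ r c → M r (swap zero c) ≡ M r c
      swapped≗M r zero = sym (same r)
      swapped≗M r (suc zero) = same r
      swapped≗M r (suc (suc c)) = refl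
    go (suc k) M (suc c) toℕc≡ same = begin
      det M           ≡⟨ sym (ℤ.neg-involutive (det M)) ⟩
      - - det M       ≡⟨ cong -_ (sym (det-swap M (suc c))) ⟩
      - det N         ≡⟨ cong -_ (go k N (inject₁ c) (trans (Fin.toℕ-inject₁ c) (ℕ.suc-injective toℕc≡)) sameN) ⟩
      - 0ℤ            ∎
      where
      N : Mat (suc n)
      N r c′ = M r (swap (suc c) c′)
      sameN : ∀ r → N r zero ≡ N r (suc (inject₁ c))
      sameN r = trans (same r) (cong (λ k → M r (suc k)) (sym (swap-inject₁ c)))

  det-add-column₀ : ∀ {n} (M : Mat (suc n)) (c : Fin n) (a b : ℤ) →
    det (M [ suc c ]≔ (λ r → a * M r (suc c) + b * M r zero)) ≡ a * det M
  det-add-column₀ M c a b = begin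
    det (M [ suc c ]≔ (λ r → a * M r (suc c) + b * M r zero))
      ≡⟨ det-linear-column M (suc c) a b (λ r → M r (suc c)) (λ r → M r zero) ⟩
    a * det (M [ suc c ]≔ (λ r → M r (suc c))) + b * det (M [ suc c ]≔ (λ r → M r zero))
      ≡⟨ cong₂ (λ x y → a * x + b * y)
           (det-cong (λ r → updateAt-id-local (suc c) {λ _ → M r (suc c)} (M r) refl))
           (det-equal-columns (M [ suc c ]≔ column₀) c
             (λ r → trans (≔-elsewhere M {suc c} column₀ r (λ ())) (sym (≔-here M (suc c) column₀ r)))) ⟩
    a * det M + b * 0ℤ
      ≡⟨ solve 3 (λ a d b → a :* d :+ b :* con 0ℤ := a :* d) refl a (det M) b ⟩
    a * det M ∎
    where
    column₀ : Fin (suc _) → ℤ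
    column₀ r = M r zero

  cleared : ∀ {n} → Mat (suc n) → Fin (suc n) → Fin n → ℤ
  cleared M r c = M zero zero * M r (suc c) - M zero (suc c) * M r zero

  schur : ∀ {n} → Mat (suc n) → Mat n
  schur M r = cleared M (suc r)

  -- The first k column operations of Chiò's condensation.
  eliminated : ∀ {n} → ℕ → Mat (suc n) → Mat (suc n)
  eliminated k M r zero = M r zero
  eliminated k M r (suc c) with toℕ c ℕ.<? k
  ... | yes _ = cleared M r c
  ... | no _ = M r (suc c)

  eliminated-done : ∀ {n k} (M : Mat (suc n)) r {c} → toℕ c ℕ.< k → eliminated k M r (suc c) ≡ cleared M r c
  eliminated-done {k = k} M r {c} c<k with toℕ c ℕ.<? k
  ... | yes _ = refl
  ... | no c≮k = contradiction c<k c≮k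

  eliminated-pending : ∀ {n k} (M : Mat (suc n)) r {c} → ¬ toℕ c ℕ.< k → eliminated k M r (suc c) ≡ M r (suc c)
  eliminated-pending {k = k} M r {c} c≮k with toℕ c ℕ.<? k
  ... | yes c<k = contradiction c<k c≮k
  ... | no _ = refl

  eliminated-suc-elsewhere : ∀ {n k} (M : Mat (suc n)) r {c} → toℕ c ≢ k →
    eliminated (suc k) M r (suc c) ≡ eliminated k M r (suc c)
  eliminated-suc-elsewhere {k = k} M r {c} c≢k with toℕ c ℕ.<? k
  ... | yes c<k = eliminated-done M r (ℕ.m<n⇒m<1+n c<k)
  ... | no c≮k = eliminated-pending M r (λ c<1+k → c≮k (ℕ.≤∧≢⇒< (ℕ.s≤s⁻¹ c<1+k) c≢k))

  det-eliminated-suc : ∀ {n k} (M : Mat (suc n)) → k ℕ.< n →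
    det (eliminated (suc k) M) ≡ M zero zero * det (eliminated k M)
  det-eliminated-suc {k = k} M k<n =
    trans (det-cong step) (det-add-column₀ E c (M zero zero) (- M zero (suc c)))
    where
    E = eliminated k M
    c = fromℕ< k<n
    toℕc≡k : toℕ c ≡ k
    toℕc≡k = Fin.toℕ-fromℕ< k<n
    column : Fin _ → ℤ
    column r = M zero zero * E r (suc c) + - M zero (suc c) * E r zero
    step : ∀ r j → eliminated (suc k) M r j ≡ (E [ suc c ]≔ column) r j
    step r zero = sym (≔-elsewhere E {suc c} {zero} column r (λ ()))
    step r (suc j) with j Fin.≟ c
    ... | yes refl = begin
      eliminated (suc k) M r (suc j)
        ≡⟨ eliminated-done M r (ℕ.≤-reflexive (cong suc toℕc≡k)) ⟩
      M zero zero * M r (suc j) - M zero (suc j) * M r zero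
        ≡⟨ cong (M zero zero * M r (suc j) +_) (ℤ.neg-distribˡ-* (M zero (suc j)) (M r zero)) ⟩
      M zero zero * M r (suc j) + - M zero (suc j) * M r zero
        ≡⟨ cong (λ x → M zero zero * x + - M zero (suc j) * M r zero)
             (sym (eliminated-pending M r (λ j<k → ℕ.<-irrefl toℕc≡k j<k))) ⟩
      M zero zero * E r (suc j) + - M zero (suc j) * E r zero
        ≡⟨ sym (≔-here E (suc j) column r) ⟩
      (E [ suc j ]≔ column) r (suc j) ∎
    ... | no j≢c = trans (eliminated-suc-elsewhere M r (λ j≡k → j≢c (Fin.toℕ-injective (trans j≡k (sym toℕc≡k)))))
                         (sym (≔-elsewhere E column r (λ e → j≢c (Fin.suc-injective e))))

  det-eliminated : ∀ {n} (M : Mat (suc n)) k → k ℕ.≤ n → det (eliminated k M) ≡ M zero zero ^ k * det M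
  det-eliminated M zero _ = trans (det-cong nothing-eliminated) (sym (ℤ.*-identityˡ (det M)))
    where
    nothing-eliminated : ∀ r c → eliminated zero M r c ≡ M r c
    nothing-eliminated r zero = refl
    nothing-eliminated r (suc c) = eliminated-pending {k = zero} M r (λ ())
  det-eliminated M (suc k) k<n = begin
    det (eliminated (suc k) M)                ≡⟨ det-eliminated-suc M k<n ⟩
    p * det (eliminated k M)                  ≡⟨ cong (p *_) (det-eliminated M k (ℕ.<⇒≤ k<n)) ⟩
    p * (p ^ k * det M)                       ≡⟨ sym (ℤ.*-assoc p (p ^ k) (det M)) ⟩
    p ^ suc k * det M                         ∎
    where
    p = M zero zero

  -- After eliminating every column the first row is (p, 0, …, 0), so only the first Laplace term survives.
  det-eliminated-all : ∀ {n} (M : Mat (suc n)) → det (eliminated n M) ≡ M zero zero * det (schur M)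
  det-eliminated-all {n} M = begin
    det E
      ≡⟨ cong₂ _+_ (ℤ.*-identityˡ (M zero zero * det (minor E zero)))
           (trans (sumℤ≡sum rest) (trans (sum-cong-≗ rest≡0) (sum-replicate-zero n))) ⟩
    M zero zero * det (minor E zero) + 0ℤ
      ≡⟨ ℤ.+-identityʳ _ ⟩
    M zero zero * det (minor E zero)
      ≡⟨ cong (M zero zero *_) (det-cong (λ r c → eliminated-done M (suc r) (Fin.toℕ<n c))) ⟩
    M zero zero * det (schur M) ∎
    where
    E = eliminated n M
    rest : Fin n → ℤ
    rest c = laplaceTerm E (suc c)
    rest≡0 : ∀ c → rest c ≡ 0ℤ
    rest≡0 c = begin
      sign (suc c) * (E zero (suc c) * det (minor E (suc c)))
        ≡⟨ cong (λ x → sign (suc c) * (x * det (minor E (suc c)))) (eliminated-done M zero (Fin.toℕ<n c)) ⟩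
      sign (suc c) * ((M zero zero * M zero (suc c) - M zero (suc c) * M zero zero) * det (minor E (suc c)))
        ≡⟨ solve 4 (λ s p x d → s :* ((p :* x :- x :* p) :* d) := con 0ℤ)
             refl (sign (suc c)) (M zero zero) (M zero (suc c)) (det (minor E (suc c))) ⟩
      0ℤ ∎

  chiò-condensation : ∀ {n} (M : Mat (suc n)) → M zero zero * det (schur M) ≡ M zero zero ^ n * det M
  chiò-condensation {n} M = trans (sym (det-eliminated-all M)) (det-eliminated M n ℕ.≤-refl)

module Positivity where

  open import Data.Rational using (ℚ; 0ℚ; 1ℚ; _+_; _*_; -_; _-_; _⊓_; _≤_; _<_; _<?_; _≤?_; _≟_; 1/_;
    toℚᵘ; positive; nonNegative; nonPositive)
  import Data.Rational.Properties as ℚ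
  import Data.Rational.Unnormalised as ℚᵘ
  import Data.Rational.Unnormalised.Properties as ℚᵘ
  open import Data.Rational.Solver using (module +-*-Solver)
  open +-*-Solver
  open import Algebra.Bundles using (CommutativeRing)
  open import Algebra.Properties.Semiring.Sum (CommutativeRing.semiring ℚ.+-*-commutativeRing)
    using (sum; sum-cong-≗; ∑-distrib-+; *-distribˡ-sum; sum-remove; sum-replicate-zero)
  open Determinant using (schur; chiò-condensation)
  open ≡-Reasoning

  -- toℚ z = z / 1 is definitionally fromℚᵘ of the unnormalised z / 1, so the ring laws transfer via toℚᵘ.
  toℚᵘ-toℚ : ∀ z → toℚᵘ (toℚ z) ℚᵘ.≃ ℚᵘ.mkℚᵘ z 0
  toℚᵘ-toℚ z = ℚ.toℚᵘ-fromℚᵘ (ℚᵘ.mkℚᵘ z 0)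

  toℚ-≡ : ∀ z p → toℚᵘ p ℚᵘ.≃ ℚᵘ.mkℚᵘ z 0 → toℚ z ≡ p
  toℚ-≡ z p p≃z = ℚ.toℚᵘ-injective (ℚᵘ.≃-trans (toℚᵘ-toℚ z) (ℚᵘ.≃-sym p≃z))

  toℚ-+ : ∀ a b → toℚ (a ℤ.+ b) ≡ toℚ a + toℚ b
  toℚ-+ a b = toℚ-≡ (a ℤ.+ b) (toℚ a + toℚ b) (ℚᵘ.≃-trans (ℚ.toℚᵘ-homo-+ (toℚ a) (toℚ b))
    (ℚᵘ.≃-trans (ℚᵘ.+-cong (toℚᵘ-toℚ a) (toℚᵘ-toℚ b))
      (ℚᵘ.*≡* (cong (ℤ._* ℤ.+ 1) (cong₂ ℤ._+_ (ℤ.*-identityʳ a) (ℤ.*-identityʳ b))))))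

  toℚ-* : ∀ a b → toℚ (a ℤ.* b) ≡ toℚ a * toℚ b
  toℚ-* a b = toℚ-≡ (a ℤ.* b) (toℚ a * toℚ b) (ℚᵘ.≃-trans (ℚ.toℚᵘ-homo-* (toℚ a) (toℚ b))
    (ℚᵘ.≃-trans (ℚᵘ.*-cong (toℚᵘ-toℚ a) (toℚᵘ-toℚ b)) (ℚᵘ.*≡* refl)))

  toℚ-neg : ∀ a → toℚ (ℤ.- a) ≡ - toℚ a
  toℚ-neg a = toℚ-≡ (ℤ.- a) (- toℚ a)
    (ℚᵘ.≃-trans (ℚ.toℚᵘ-homo‿- (toℚ a)) (ℚᵘ.≃-trans (ℚᵘ.-‿cong (toℚᵘ-toℚ a)) (ℚᵘ.*≡* refl)))

  toℚ-mono-≤ : ∀ {a b} → a ℤ.≤ b → toℚ a ≤ toℚ b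
  toℚ-mono-≤ {a} {b} a≤b = ℚ.toℚᵘ-cancel-≤
    (ℚᵘ.≤-respʳ-≃ (ℚᵘ.≃-sym (toℚᵘ-toℚ b)) (ℚᵘ.≤-respˡ-≃ (ℚᵘ.≃-sym (toℚᵘ-toℚ a))
      (ℚᵘ.*≤* (subst₂ ℤ._≤_ (sym (ℤ.*-identityʳ a)) (sym (ℤ.*-identityʳ b)) a≤b))))

  toℚ-cancel-≤ : ∀ {a b} → toℚ a ≤ toℚ b → a ℤ.≤ b
  toℚ-cancel-≤ {a} {b} toℚa≤toℚb
    with ℚᵘ.≤-respʳ-≃ (toℚᵘ-toℚ b) (ℚᵘ.≤-respˡ-≃ (toℚᵘ-toℚ a) (ℚ.toℚᵘ-mono-≤ toℚa≤toℚb))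
  ... | ℚᵘ.*≤* a*1≤b*1 = subst₂ ℤ._≤_ (ℤ.*-identityʳ a) (ℤ.*-identityʳ b) a*1≤b*1

  toℚ-injective : ∀ {a b} → toℚ a ≡ toℚ b → a ≡ b
  toℚ-injective e = ℤ.≤-antisym (toℚ-cancel-≤ (ℚ.≤-reflexive e)) (toℚ-cancel-≤ (ℚ.≤-reflexive (sym e)))

  inverse : ∀ a → 0ℚ < a → ℚ
  inverse a a>0 = (1/ a) {{ℚ.pos⇒nonZero a {{positive a>0}}}}

  *-inverse : ∀ a a>0 → a * inverse a a>0 ≡ 1ℚ
  *-inverse a a>0 = ℚ.*-inverseʳ a {{ℚ.pos⇒nonZero a {{positive a>0}}}}

  inverse-pos : ∀ a a>0 → 0ℚ < inverse a a>0
  inverse-pos a a>0 = ℚ.positive⁻¹ _ {{ℚ.1/pos⇒pos a {{positive a>0}}}}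

  nonNeg*nonNeg : ∀ {a b} → 0ℚ ≤ a → 0ℚ ≤ b → 0ℚ ≤ a * b
  nonNeg*nonNeg {a} {b} a≥0 b≥0 =
    ℚ.nonNegative⁻¹ _ {{ℚ.nonNeg*nonNeg⇒nonNeg a {{nonNegative a≥0}} b {{nonNegative b≥0}}}}

  pos*pos : ∀ {a b} → 0ℚ < a → 0ℚ < b → 0ℚ < a * b
  pos*pos {a} {b} a>0 b>0 = ℚ.positive⁻¹ _ {{ℚ.pos*pos⇒pos a {{positive a>0}} b {{positive b>0}}}}

  nonPos*nonNeg : ∀ {a b} → a ≤ 0ℚ → 0ℚ ≤ b → a * b ≤ 0ℚ
  nonPos*nonNeg {a} {b} a≤0 b≥0 =
    ℚ.nonPositive⁻¹ _ {{ℚ.nonPos*nonNeg⇒nonPos a {{nonPositive a≤0}} b {{nonNegative b≥0}}}}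

  *-cancelʳ-pos : ∀ {x y} → 0ℚ < y → x * y ≡ 0ℚ → x ≡ 0ℚ
  *-cancelʳ-pos {x} {y} y>0 xy≡0 = begin
    x                        ≡⟨ sym (ℚ.*-identityʳ x) ⟩
    x * 1ℚ                   ≡⟨ cong (x *_) (sym (*-inverse y y>0)) ⟩
    x * (y * inverse y y>0)  ≡⟨ sym (ℚ.*-assoc x y _) ⟩
    x * y * inverse y y>0    ≡⟨ cong (_* inverse y y>0) xy≡0 ⟩
    0ℚ * inverse y y>0       ≡⟨ ℚ.*-zeroˡ (inverse y y>0) ⟩
    0ℚ                       ∎

  nonNeg*nonPos : ∀ {a b} → 0ℚ ≤ a → b ≤ 0ℚ → a * b ≤ 0ℚ
  nonNeg*nonPos {a} {b} a≥0 b≤0 =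
    ℚ.nonPositive⁻¹ _ {{ℚ.nonNeg*nonPos⇒nonPos a {{nonNegative a≥0}} b {{nonPositive b≤0}}}}

  nonPos*nonPos : ∀ {a b} → a ≤ 0ℚ → b ≤ 0ℚ → 0ℚ ≤ a * b
  nonPos*nonPos {a} {b} a≤0 b≤0 =
    ℚ.nonNegative⁻¹ _ {{ℚ.nonPos*nonPos⇒nonPos a {{nonPositive a≤0}} b {{nonPositive b≤0}}}}

  +-nonnegʳ : ∀ a {b} → 0ℚ ≤ b → a ≤ a + b
  +-nonnegʳ a b≥0 = ℚ.≤-trans (ℚ.≤-reflexive (sym (ℚ.+-identityʳ a))) (ℚ.+-monoʳ-≤ a b≥0)

  +-nonnegˡ : ∀ {a} b → 0ℚ ≤ a → b ≤ a + b
  +-nonnegˡ b a≥0 = ℚ.≤-trans (ℚ.≤-reflexive (sym (ℚ.+-identityˡ b))) (ℚ.+-monoˡ-≤ b a≥0)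

  +-nonposʳ : ∀ a {b} → b ≤ 0ℚ → a + b ≤ a
  +-nonposʳ a b≤0 = ℚ.≤-trans (ℚ.+-monoʳ-≤ a b≤0) (ℚ.≤-reflexive (ℚ.+-identityʳ a))

  +-nonposˡ : ∀ {a} b → a ≤ 0ℚ → a + b ≤ b
  +-nonposˡ b a≤0 = ℚ.≤-trans (ℚ.+-monoˡ-≤ b a≤0) (ℚ.≤-reflexive (ℚ.+-identityˡ b))

  nonNeg+nonNeg≡0 : ∀ {a b} → 0ℚ ≤ a → 0ℚ ≤ b → a + b ≡ 0ℚ → a ≡ 0ℚ × b ≡ 0ℚ
  nonNeg+nonNeg≡0 {a} {b} a≥0 b≥0 a+b≡0 =
    ℚ.≤-antisym (ℚ.≤-trans (+-nonnegʳ a b≥0) (ℚ.≤-reflexive a+b≡0)) a≥0 ,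
    ℚ.≤-antisym (ℚ.≤-trans (+-nonnegˡ b a≥0) (ℚ.≤-reflexive a+b≡0)) b≥0

  nonPos+nonPos≡0 : ∀ {a b} → a ≤ 0ℚ → b ≤ 0ℚ → a + b ≡ 0ℚ → a ≡ 0ℚ × b ≡ 0ℚ
  nonPos+nonPos≡0 {a} {b} a≤0 b≤0 a+b≡0 =
    ℚ.≤-antisym a≤0 (ℚ.≤-trans (ℚ.≤-reflexive (sym a+b≡0)) (+-nonposʳ a b≤0)) ,
    ℚ.≤-antisym b≤0 (ℚ.≤-trans (ℚ.≤-reflexive (sym a+b≡0)) (+-nonposˡ b a≤0))

  nonNeg∧≢0⇒pos : ∀ {x} → 0ℚ ≤ x → x ≢ 0ℚ → 0ℚ < x
  nonNeg∧≢0⇒pos {x} x≥0 x≢0 with 0ℚ <? x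
  ... | yes x>0 = x>0
  ... | no x≯0 = contradiction (ℚ.≤-antisym (ℚ.≮⇒≥ x≯0) x≥0) x≢0

  sumℚ≡sum : ∀ {n} (f : Fin n → ℚ) → sumℚ f ≡ sum f
  sumℚ≡sum {zero} f = refl
  sumℚ≡sum {suc n} f = cong (f zero +_) (sumℚ≡sum (λ i → f (suc i)))

  sumℚ-cong : ∀ {n} {f g : Fin n → ℚ} → (∀ i → f i ≡ g i) → sumℚ f ≡ sumℚ g
  sumℚ-cong {f = f} {g} f≗g = trans (sumℚ≡sum f) (trans (sum-cong-≗ f≗g) (sym (sumℚ≡sum g)))

  sumℚ-linear : ∀ {n} (a b : ℚ) (f g : Fin n → ℚ) → sumℚ (λ i → a * f i + b * g i) ≡ a * sumℚ f + b * sumℚ g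
  sumℚ-linear a b f g = begin
    sumℚ (λ i → a * f i + b * g i)             ≡⟨ sumℚ≡sum (λ i → a * f i + b * g i) ⟩
    sum (λ i → a * f i + b * g i)              ≡⟨ ∑-distrib-+ (λ i → a * f i) (λ i → b * g i) ⟩
    sum (λ i → a * f i) + sum (λ i → b * g i)  ≡⟨ sym (cong₂ _+_ (*-distribˡ-sum a f) (*-distribˡ-sum b g)) ⟩
    a * sum f + b * sum g                      ≡⟨ sym (cong₂ (λ x y → a * x + b * y) (sumℚ≡sum f) (sumℚ≡sum g)) ⟩
    a * sumℚ f + b * sumℚ g                    ∎

  sumℚ-scale : ∀ {n} (a : ℚ) (f : Fin n → ℚ) → sumℚ (λ i → a * f i) ≡ a * sumℚ f
  sumℚ-scale a f = begin
    sumℚ (λ i → a * f i)  ≡⟨ sumℚ≡sum (λ i → a * f i) ⟩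
    sum (λ i → a * f i)   ≡⟨ sym (*-distribˡ-sum a f) ⟩
    a * sum f             ≡⟨ cong (a *_) (sym (sumℚ≡sum f)) ⟩
    a * sumℚ f            ∎

  sumℚ-zero : ∀ {n} {f : Fin n → ℚ} → (∀ i → f i ≡ 0ℚ) → sumℚ f ≡ 0ℚ
  sumℚ-zero {n} {f} f≗0 = trans (sumℚ≡sum f) (trans (sum-cong-≗ f≗0) (sum-replicate-zero n))

  sumℚ-point : ∀ {n} (a : Fin n) (g g′ : Fin n → ℚ) → (∀ j → j ≢ a → g′ j ≡ g j) → g′ a ≡ 0ℚ →
    sumℚ g ≡ g a + sumℚ g′
  sumℚ-point {suc n} a g g′ agree g′a≡0 = begin
    sumℚ g                                          ≡⟨ sumℚ≡sum g ⟩
    sum g                                           ≡⟨ sum-remove {i = a} g ⟩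
    g a + sum (λ k → g (punchIn a k))               ≡⟨ cong (g a +_) (sum-cong-≗ agree′) ⟩
    g a + sum (λ k → g′ (punchIn a k))              ≡⟨ cong (g a +_) (sym (ℚ.+-identityˡ _)) ⟩
    g a + (0ℚ + sum (λ k → g′ (punchIn a k)))
      ≡⟨ cong (λ x → g a + (x + sum (λ k → g′ (punchIn a k)))) (sym g′a≡0) ⟩
    g a + (g′ a + sum (λ k → g′ (punchIn a k)))
      ≡⟨ cong (g a +_) (sym (trans (sumℚ≡sum g′) (sum-remove {i = a} g′))) ⟩
    g a + sumℚ g′                                   ∎
    where
    agree′ : ∀ k → g (punchIn a k) ≡ g′ (punchIn a k)
    agree′ k = sym (agree (punchIn a k) (Fin.punchInᵢ≢i a k))

  sumℚ-nonpos : ∀ {n} {f : Fin n → ℚ} → (∀ i → f i ≤ 0ℚ) → sumℚ f ≤ 0ℚ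
  sumℚ-nonpos {zero} _ = ℚ.≤-refl
  sumℚ-nonpos {suc n} f≤0 = ℚ.+-mono-≤ (f≤0 zero) (sumℚ-nonpos (λ i → f≤0 (suc i)))

  sumℚ-nonpos-zero : ∀ {n} {f : Fin n → ℚ} → (∀ i → f i ≤ 0ℚ) → 0ℚ ≤ sumℚ f → ∀ i → f i ≡ 0ℚ
  sumℚ-nonpos-zero {suc n} {f} f≤0 sum≥0 zero =
    ℚ.≤-antisym (f≤0 zero) (ℚ.≤-trans sum≥0 (+-nonposʳ (f zero) (sumℚ-nonpos (λ i → f≤0 (suc i)))))
  sumℚ-nonpos-zero {suc n} {f} f≤0 sum≥0 (suc i) =
    sumℚ-nonpos-zero (λ i → f≤0 (suc i)) (ℚ.≤-trans sum≥0 (+-nonposˡ (sumℚ (λ i → f (suc i))) (f≤0 zero))) i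

  ·-cong : ∀ {n} (A : Mat n) {v w : Vecℚ n} → (∀ j → v j ≡ w j) → ∀ i → (A · v) i ≡ (A · w) i
  ·-cong A v≗w i = sumℚ-cong (λ j → cong (toℚ (A i j) *_) (v≗w j))

  ·-linear : ∀ {n} (A : Mat n) (v w : Vecℚ n) (t : ℚ) i → (A · (λ j → v j + t * w j)) i ≡ (A · v) i + t * (A · w) i
  ·-linear A v w t i = begin
    (A · (λ j → v j + t * w j)) i
      ≡⟨ sumℚ-cong distribute ⟩
    sumℚ (λ j → 1ℚ * (toℚ (A i j) * v j) + t * (toℚ (A i j) * w j))
      ≡⟨ sumℚ-linear 1ℚ t (λ j → toℚ (A i j) * v j) (λ j → toℚ (A i j) * w j) ⟩
    1ℚ * (A · v) i + t * (A · w) i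
      ≡⟨ cong (_+ t * (A · w) i) (ℚ.*-identityˡ ((A · v) i)) ⟩
    (A · v) i + t * (A · w) i ∎
    where
    distribute : ∀ j → toℚ (A i j) * (v j + t * w j) ≡ 1ℚ * (toℚ (A i j) * v j) + t * (toℚ (A i j) * w j)
    distribute j = solve 4 (λ a v t w → a :* (v :+ t :* w) := con 1ℚ :* (a :* v) :+ t :* (a :* w))
      refl (toℚ (A i j)) (v j) t (w j)

  ·-neg : ∀ {n} (A : Mat n) (v : Vecℚ n) i → (A · (λ j → - v j)) i ≡ - (A · v) i
  ·-neg A v i = begin
    (A · (λ j → - v j)) i                    ≡⟨ sumℚ-cong negate ⟩
    sumℚ (λ j → - 1ℚ * (toℚ (A i j) * v j))  ≡⟨ sumℚ-scale (- 1ℚ) (λ j → toℚ (A i j) * v j) ⟩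
    - 1ℚ * (A · v) i                         ≡⟨ solve 1 (λ x → :- con 1ℚ :* x := :- x) refl ((A · v) i) ⟩
    - (A · v) i                              ∎
    where
    negate : ∀ j → toℚ (A i j) * - v j ≡ - 1ℚ * (toℚ (A i j) * v j)
    negate j = solve 2 (λ a v → a :* (:- v) := :- con 1ℚ :* (a :* v)) refl (toℚ (A i j)) (v j)

  ·-zero : ∀ {n} (A : Mat n) {v : Vecℚ n} → IsZero v → IsZero (A · v)
  ·-zero A v≡0 i = sumℚ-zero (λ j → trans (cong (toℚ (A i j) *_) (v≡0 j)) (ℚ.*-zeroʳ (toℚ (A i j))))

  offImage : ∀ {m n} → (Fin m → Fin n) → (Fin n → ℚ) → Fin n → ℚ
  offImage f h j with Im? f j
  ... | yes _ = 0ℚ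
  ... | no _ = h j

  offImage-image : ∀ {m n} (f : Fin m → Fin n) h {j} → Im f j → offImage f h j ≡ 0ℚ
  offImage-image f h {j} imj with Im? f j
  ... | yes _ = refl
  ... | no ¬imj = contradiction imj ¬imj

  offImage-outside : ∀ {m n} (f : Fin m → Fin n) h {j} → ¬ Im f j → offImage f h j ≡ h j
  offImage-outside f h {j} ¬imj with Im? f j
  ... | yes imj = contradiction imj ¬imj
  ... | no _ = refl

  sumℚ-image : ∀ {m n} {f : Fin m → Fin n} → Injective _≡_ _≡_ f → (h : Fin n → ℚ) →
    sumℚ h ≡ sumℚ (λ i → h (f i)) + sumℚ (offImage f h)
  sumℚ-image {zero} {f = f} _ h =
    trans (sumℚ-cong {f = h} (λ j → sym (offImage-outside f h {j} λ { (() , _) })))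
          (sym (ℚ.+-identityˡ (sumℚ (offImage f h))))
  sumℚ-image {suc m} {f = f} inj h = begin
    sumℚ h
      ≡⟨ sumℚ-image {f = f′} (λ e → Fin.suc-injective (inj e)) h ⟩
    sumℚ (λ i → h (f′ i)) + sumℚ (offImage f′ h)
      ≡⟨ cong (sumℚ (λ i → h (f′ i)) +_) peel ⟩
    sumℚ (λ i → h (f′ i)) + (h (f zero) + sumℚ (offImage f h))
      ≡⟨ solve 3 (λ x y z → x :+ (y :+ z) := y :+ x :+ z)
           refl (sumℚ (λ i → h (f′ i))) (h (f zero)) (sumℚ (offImage f h)) ⟩
    sumℚ (λ i → h (f i)) + sumℚ (offImage f h) ∎
    where
    f′ : Fin m → _
    f′ i = f (suc i)
    f₀∉f′ : ¬ Im f′ (f zero)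
    f₀∉f′ (i , e) with inj e
    ... | ()
    agree : ∀ j → j ≢ f zero → offImage f h j ≡ offImage f′ h j
    agree j j≢f₀ = by-cases (Im? f′ j)
      where
      by-cases : Dec (Im f′ j) → offImage f h j ≡ offImage f′ h j
      by-cases (yes (i , e)) = trans (offImage-image f h (suc i , e)) (sym (offImage-image f′ h (i , e)))
      by-cases (no j∉f′) = trans (offImage-outside f h j∉f) (sym (offImage-outside f′ h j∉f′))
        where
        j∉f : ¬ Im f j
        j∉f (zero , e) = j≢f₀ (sym e)
        j∉f (suc i , e) = j∉f′ (i , e)
    peel : sumℚ (offImage f′ h) ≡ h (f zero) + sumℚ (offImage f h)
    peel = trans (sumℚ-point (f zero) (offImage f′ h) (offImage f h) agree (offImage-image f h (zero , refl)))
                 (cong (_+ sumℚ (offImage f h)) (offImage-outside f′ h f₀∉f′))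

  Witness≥ : ∀ {n} → Mat n → Set
  Witness≥ {n} A = Σ (Vecℚ n) λ u → Pos u × NonNeg (A · u)

  Witness≩ : ∀ {n} → Mat n → Set
  Witness≩ {n} A = Σ (Vecℚ n) λ u → Pos u × NonNeg (A · u) × ¬ IsZero (A · u)

  TrivialKernel : ∀ {n} → Mat n → Set
  TrivialKernel {n} A = ∀ v → IsZero (A · v) → IsZero v

  Witness> : ∀ {n} → Mat n → Set
  Witness> {n} A = Σ (Vecℚ n) λ u → Pos u × Pos (A · u)

  finite⇒witness≥ : ∀ {n} {A : Mat n} → IsFinite A → Witness≥ A
  finite⇒witness≥ (_ , _ , (u , u>0 , Au>0) , _) = u , u>0 , λ i → ℚ.<⇒≤ (Au>0 i)

  affine⇒witness≥ : ∀ {n} {A : Mat n} → IsAffine A → Witness≥ A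
  affine⇒witness≥ (_ , _ , (u , u>0 , Au≡0) , _) = u , u>0 , λ i → ℚ.≤-reflexive (sym (Au≡0 i))

  restrict-witness : ∀ {m n} (A : Mat n) → ZMatrix A → Indecomposable A → Witness≥ A →
    {f : Fin m → Fin n} → Injective _≡_ _≡_ f → 1 ℕ.≤ m → m ℕ.< n → Witness≩ (sub A f)
  restrict-witness {m} A offDiag≤0 ind (u , u>0 , Au≥0) {f} inj 1≤m m<n =
    u′ , (λ i → u>0 (f i)) , Bu′≥0 , Bu′≢0
    where
    u′ : Vecℚ m
    u′ i = u (f i)
    term : Fin m → Fin _ → ℚ
    term i j = toℚ (A (f i) j) * u j
    dropped : Fin m → ℚ
    dropped i = sumℚ (offImage f (term i))
    split : ∀ i → (A · u) (f i) ≡ (sub A f · u′) i + dropped i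
    split i = sumℚ-image inj (term i)
    offImage≤0 : ∀ i j → offImage f (term i) j ≤ 0ℚ
    offImage≤0 i j = by-cases (Im? f j)
      where
      by-cases : Dec (Im f j) → offImage f (term i) j ≤ 0ℚ
      by-cases (yes imj) = ℚ.≤-reflexive (offImage-image f (term i) imj)
      by-cases (no j∉f) = subst (_≤ 0ℚ) (sym (offImage-outside f (term i) j∉f))
        (nonPos*nonNeg (toℚ-mono-≤ (offDiag≤0 (f i) j (λ e → j∉f (i , e)))) (ℚ.<⇒≤ (u>0 j)))
    Bu′≥0 : NonNeg (sub A f · u′)
    Bu′≥0 i = ℚ.≤-trans (Au≥0 (f i))
      (subst (_≤ (sub A f · u′) i) (sym (split i)) (+-nonposʳ _ (sumℚ-nonpos (offImage≤0 i))))
    Bu′≢0 : ¬ IsZero (sub A f · u′)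
    Bu′≢0 Bu′≡0 with edgeLeavingImage A ind inj 1≤m m<n
    ... | i , j , j∉f , nonzero = nonzero (toℚ-injective (*-cancelʳ-pos (u>0 j) term≡0))
      where
      dropped≥0 : 0ℚ ≤ dropped i
      dropped≥0 = subst (0ℚ ≤_) (trans (split i) (trans (cong (_+ dropped i) (Bu′≡0 i)) (ℚ.+-identityˡ (dropped i))))
        (Au≥0 (f i))
      term≡0 : term i j ≡ 0ℚ
      term≡0 = trans (sym (offImage-outside f (term i) j∉f)) (sumℚ-nonpos-zero (offImage≤0 i) dropped≥0 j)

  nonNeg⇒pos⊎zero : ∀ {n} (A : Mat n) → ZMatrix A → Indecomposable A →
    ∀ w → NonNeg w → NonNeg (A · w) → Pos w ⊎ IsZero w
  nonNeg⇒pos⊎zero {n} A offDiag≤0 ind w w≥0 Aw≥0 with Fin.all? (λ i → 0ℚ <? w i)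
  ... | yes w>0 = inj₁ w>0
  ... | no ¬w>0 = inj₂ w≡0
    where
    zeroAt : ∃ λ i₀ → w i₀ ≡ 0ℚ
    zeroAt with Fin.¬∀⟶∃¬ n _ (λ i → 0ℚ <? w i) ¬w>0
    ... | i₀ , w₀≯0 = i₀ , ℚ.≤-antisym (ℚ.≮⇒≥ w₀≯0) (w≥0 i₀)
    noEdgesOut : NoEdgesOut A (λ j → w j ≡ 0ℚ)
    noEdgesOut a b wa≡0 wb≢0 =
      toℚ-injective (*-cancelʳ-pos (nonNeg∧≢0⇒pos (w≥0 b) wb≢0) (sumℚ-nonpos-zero term≤0 (Aw≥0 a) b))
      where
      term≤0 : ∀ j → toℚ (A a j) * w j ≤ 0ℚ
      term≤0 j with j Fin.≟ a
      ... | yes refl = ℚ.≤-reflexive (trans (cong (toℚ (A j j) *_) wa≡0) (ℚ.*-zeroʳ (toℚ (A j j))))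
      ... | no j≢a = nonPos*nonNeg (toℚ-mono-≤ (offDiag≤0 a j (λ e → j≢a (sym e)))) (w≥0 j)
    w≡0 : IsZero w
    w≡0 i with w i ≟ 0ℚ
    ... | yes wi≡0 = wi≡0
    ... | no wi≢0 = ⊥-elim (indecomposable⇒¬NoEdgesOut ind (λ j → w j ≟ 0ℚ) (proj₂ zeroAt) wi≢0 noEdgesOut)

  argmax : ∀ {n} (g : Fin (suc n) → ℚ) → ∃ λ i₀ → ∀ i → g i ≤ g i₀
  argmax {zero} g = zero , λ { zero → ℚ.≤-refl }
  argmax {suc n} g with argmax (λ i → g (suc i))
  ... | j , gj-max with g zero ≤? g (suc j)
  ...   | yes g₀≤gj = suc j , λ { zero → g₀≤gj ; (suc i) → gj-max i }
  ...   | no g₀≰gj = zero , λ { zero → ℚ.≤-refl ; (suc i) → ℚ.≤-trans (gj-max i) (ℚ.<⇒≤ (ℚ.≰⇒> g₀≰gj)) }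

  -- t = max (- vᵢ / uᵢ) is the least t with v + t u ≥ 0.
  boundaryShift : ∀ {n} (u v : Vecℚ (suc n)) → Pos u →
    ∃ λ t → NonNeg (λ i → v i + t * u i) × ∃ λ i₀ → v i₀ + t * u i₀ ≡ 0ℚ
  boundaryShift u v u>0 = t , w≥0 , i₀ , trans (cong (v i₀ +_) (ratio*u i₀)) (ℚ.+-inverseʳ (v i₀))
    where
    ratio : Fin _ → ℚ
    ratio i = - v i * inverse (u i) (u>0 i)
    i₀ = proj₁ (argmax ratio)
    t = ratio i₀
    ratio*u : ∀ i → ratio i * u i ≡ - v i
    ratio*u i = begin
      - v i * inverse (u i) (u>0 i) * u i      ≡⟨ ℚ.*-assoc (- v i) _ (u i) ⟩
      - v i * (inverse (u i) (u>0 i) * u i)    ≡⟨ cong (- v i *_) (trans (ℚ.*-comm _ (u i)) (*-inverse (u i) (u>0 i))) ⟩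
      - v i * 1ℚ                               ≡⟨ ℚ.*-identityʳ (- v i) ⟩
      - v i                                    ∎
    w≥0 : NonNeg (λ i → v i + t * u i)
    w≥0 i = ℚ.≤-trans (ℚ.≤-reflexive (sym (ℚ.+-inverseʳ (v i))))
      (ℚ.+-monoʳ-≤ (v i) (subst (_≤ t * u i) (ratio*u i)
        (ℚ.*-monoʳ-≤-nonNeg (u i) {{nonNegative (ℚ.<⇒≤ (u>0 i))}} (proj₂ (argmax ratio) i))))

  -- If t ≤ 0 then v ≥ 0 already; if t > 0 then w = v + t u ≥ 0 vanishes somewhere, so w = 0 and A u = 0.
  witness≩⇒pos⊎zero : ∀ {n} (A : Mat n) → ZMatrix A → Indecomposable A → Witness≩ A →
    ∀ v → NonNeg (A · v) → Pos v ⊎ IsZero v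
  witness≩⇒pos⊎zero {zero} _ _ _ _ v _ = inj₂ (λ ())
  witness≩⇒pos⊎zero {suc n} A offDiag≤0 ind (u , u>0 , Au≥0 , Au≢0) v Av≥0 with boundaryShift u v u>0
  ... | t , w≥0 , i₀ , w₀≡0 = by-sign (t ≤? 0ℚ)
    where
    w : Vecℚ (suc n)
    w i = v i + t * u i
    by-sign : Dec (t ≤ 0ℚ) → Pos v ⊎ IsZero v
    by-sign (yes t≤0) = nonNeg⇒pos⊎zero A offDiag≤0 ind v v≥0 Av≥0
      where
      v≥0 : NonNeg v
      v≥0 i = subst (0ℚ ≤_) (solve 3 (λ v t u → v :+ t :* u :+ (:- t) :* u := v) refl (v i) t (u i))
        (ℚ.+-mono-≤ (w≥0 i) (nonNeg*nonNeg (ℚ.neg-antimono-≤ t≤0) (ℚ.<⇒≤ (u>0 i))))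
    by-sign (no t≰0) = ⊥-elim (refute (nonNeg⇒pos⊎zero A offDiag≤0 ind w w≥0 Aw≥0))
      where
      t>0 : 0ℚ < t
      t>0 = ℚ.≰⇒> t≰0
      tAu≥0 : ∀ i → 0ℚ ≤ t * (A · u) i
      tAu≥0 i = nonNeg*nonNeg (ℚ.<⇒≤ t>0) (Au≥0 i)
      Aw≥0 : NonNeg (A · w)
      Aw≥0 i = subst (0ℚ ≤_) (sym (·-linear A v u t i)) (ℚ.+-mono-≤ (Av≥0 i) (tAu≥0 i))
      refute : Pos w ⊎ IsZero w → ⊥
      refute (inj₁ w>0) = ℚ.<-irrefl (sym w₀≡0) (w>0 i₀)
      refute (inj₂ w≡0) = Au≢0 Au≡0
        where
        Au≡0 : IsZero (A · u)
        Au≡0 i = *-cancelʳ-pos t>0 (trans (ℚ.*-comm ((A · u) i) t)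
          (proj₂ (nonNeg+nonNeg≡0 (Av≥0 i) (tAu≥0 i) (trans (sym (·-linear A v u t i)) (·-zero A w≡0 i)))))

  -- Otherwise row 0 of M u is a sum of terms ≤ 0, so row 0 and, by the zero pattern, column 0 vanish: e₀ ∈ ker M.
  pivot-pos : ∀ {n} (M : Mat (suc n)) → ZMatrix M → ZeroPatternSymmetric M → Witness≥ M → TrivialKernel M →
    0ℚ < toℚ (M zero zero)
  pivot-pos {n} M offDiag≤0 symmetric (u , u>0 , Mu≥0) kernel with toℚ (M zero zero) ≤? 0ℚ
  ... | no q≰0 = ℚ.≰⇒> q≰0
  ... | yes q≤0 = ⊥-elim (1ℚ≢0ℚ (kernel e₀ Me₀≡0 zero))
    where
    1ℚ≢0ℚ : 1ℚ ≢ 0ℚ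
    1ℚ≢0ℚ ()
    term≤0 : ∀ j → toℚ (M zero j) * u j ≤ 0ℚ
    term≤0 zero = nonPos*nonNeg q≤0 (ℚ.<⇒≤ (u>0 zero))
    term≤0 (suc j) = nonPos*nonNeg (toℚ-mono-≤ (offDiag≤0 zero (suc j) (λ ()))) (ℚ.<⇒≤ (u>0 (suc j)))
    row₀≡0 : ∀ j → M zero j ≡ 0ℤ
    row₀≡0 j = toℚ-injective (*-cancelʳ-pos (u>0 j) (sumℚ-nonpos-zero term≤0 (Mu≥0 zero) j))
    e₀ : Vecℚ (suc n)
    e₀ = 1ℚ ∷ λ _ → 0ℚ
    Me₀≡0 : IsZero (M · e₀)
    Me₀≡0 i = begin
      toℚ (M i zero) * 1ℚ + sumℚ (λ j → toℚ (M i (suc j)) * 0ℚ)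
        ≡⟨ cong₂ _+_ (ℚ.*-identityʳ (toℚ (M i zero))) (sumℚ-zero (λ j → ℚ.*-zeroʳ (toℚ (M i (suc j))))) ⟩
      toℚ (M i zero) + 0ℚ  ≡⟨ ℚ.+-identityʳ (toℚ (M i zero)) ⟩
      toℚ (M i zero)       ≡⟨ cong toℚ (symmetric zero i (row₀≡0 i)) ⟩
      0ℚ                   ∎

  smallPositive : ∀ {n} (s d : Fin n → ℚ) → (∀ i → 0ℚ < s i) → (∀ i → d i ≤ 0ℚ) →
    ∃ λ t → 0ℚ < t × (∀ i → 0ℚ < s i + d i * t)
  smallPositive {zero} s d _ _ = 1ℚ , ℚ.positive⁻¹ 1ℚ , λ ()
  smallPositive {suc n} s d s>0 d≤0
    with smallPositive (λ i → s (suc i)) (λ i → d (suc i)) (λ i → s>0 (suc i)) (λ i → d≤0 (suc i))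
  ... | t′ , t′>0 , t′-works = t , t>0 , t-works
    where
    1-d₀>0 : 0ℚ < 1ℚ - d zero
    1-d₀>0 = ℚ.+-mono-<-≤ (ℚ.positive⁻¹ 1ℚ) (ℚ.neg-antimono-≤ (d≤0 zero))
    r = inverse (1ℚ - d zero) 1-d₀>0
    -- h₀ = s₀ / (1 - d₀) is the point where s₀ + d₀ h₀ = h₀.
    h₀ = s zero * r
    h₀-works : s zero + d zero * h₀ ≡ h₀
    h₀-works = begin
      s zero + d zero * h₀
        ≡⟨ cong (_+ d zero * h₀) (sym (ℚ.*-identityʳ (s zero))) ⟩
      s zero * 1ℚ + d zero * h₀
        ≡⟨ cong (λ x → s zero * x + d zero * h₀) (sym (trans (ℚ.*-comm r _) (*-inverse _ 1-d₀>0))) ⟩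
      s zero * (r * (1ℚ - d zero)) + d zero * h₀
        ≡⟨ solve 3 (λ s r d → s :* (r :* (con 1ℚ :- d)) :+ d :* (s :* r) := s :* r) refl (s zero) r (d zero) ⟩
      h₀ ∎
    t = t′ ⊓ h₀
    t>0 : 0ℚ < t
    t>0 with ℚ.⊓-sel t′ h₀
    ... | inj₁ t≡t′ = subst (0ℚ <_) (sym t≡t′) t′>0
    ... | inj₂ t≡h₀ = subst (0ℚ <_) (sym t≡h₀) (pos*pos (s>0 zero) (inverse-pos _ 1-d₀>0))
    antitone : ∀ i {t₁ t₂} → t₁ ≤ t₂ → s i + d i * t₂ ≤ s i + d i * t₁
    antitone i t₁≤t₂ = ℚ.+-monoʳ-≤ (s i) (ℚ.*-monoˡ-≤-nonPos (d i) {{nonPositive (d≤0 i)}} t₁≤t₂)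
    t-works : ∀ i → 0ℚ < s i + d i * t
    t-works zero = ℚ.<-≤-trans (subst (0ℚ <_) (sym h₀-works) (pos*pos (s>0 zero) (inverse-pos _ 1-d₀>0)))
      (antitone zero (ℚ.p⊓q≤q t′ h₀))
    t-works (suc i) = ℚ.<-≤-trans (t′-works i) (antitone (suc i) (ℚ.p⊓q≤p t′ h₀))

  module SchurComplement {n} (M : Mat (suc n)) where

    S : Mat n
    S = schur M

    q : ℚ
    q = toℚ (M zero zero)

    c d : Fin n → ℚ
    c j = toℚ (M zero (suc j))
    d i = toℚ (M (suc i) zero)

    m : Fin n → Fin n → ℚ
    m i j = toℚ (M (suc i) (suc j))

    entry : ∀ i j → toℚ (S i j) ≡ q * m i j - c j * d i
    entry i j = begin
      toℚ (M zero zero ℤ.* M (suc i) (suc j) ℤ.+ ℤ.- (M zero (suc j) ℤ.* M (suc i) zero))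
        ≡⟨ toℚ-+ (M zero zero ℤ.* M (suc i) (suc j)) (ℤ.- (M zero (suc j) ℤ.* M (suc i) zero)) ⟩
      toℚ (M zero zero ℤ.* M (suc i) (suc j)) + toℚ (ℤ.- (M zero (suc j) ℤ.* M (suc i) zero))
        ≡⟨ cong₂ _+_ (toℚ-* (M zero zero) (M (suc i) (suc j)))
             (trans (toℚ-neg (M zero (suc j) ℤ.* M (suc i) zero)) (cong -_ (toℚ-* (M zero (suc j)) (M (suc i) zero)))) ⟩
      q * m i j - c j * d i ∎

    S·≡ : ∀ a w i → (S · w) i ≡ q * (M · (a ∷ w)) (suc i) - d i * (M · (a ∷ w)) zero
    S·≡ a w i = begin
      sumℚ (λ j → toℚ (S i j) * w j)
        ≡⟨ sumℚ-cong expand ⟩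
      sumℚ (λ j → q * (m i j * w j) + - d i * (c j * w j))
        ≡⟨ sumℚ-linear q (- d i) (λ j → m i j * w j) (λ j → c j * w j) ⟩
      q * sumℚ (λ j → m i j * w j) + - d i * sumℚ (λ j → c j * w j)
        ≡⟨ solve 5 (λ q d a r s → q :* r :+ (:- d) :* s := q :* (d :* a :+ r) :- d :* (q :* a :+ s))
             refl q (d i) a (sumℚ (λ j → m i j * w j)) (sumℚ (λ j → c j * w j)) ⟩
      q * (M · (a ∷ w)) (suc i) - d i * (M · (a ∷ w)) zero ∎
      where
      expand : ∀ j → toℚ (S i j) * w j ≡ q * (m i j * w j) + - d i * (c j * w j)
      expand j = trans (cong (_* w j) (entry i j))
        (solve 5 (λ q m c d w → (q :* m :- c :* d) :* w := q :* (m :* w) :+ (:- d) :* (c :* w)) refl q (m i j) (c j) (d i) (w j))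

    c≤0 : ZMatrix M → ∀ j → c j ≤ 0ℚ
    c≤0 offDiag≤0 j = toℚ-mono-≤ (offDiag≤0 zero (suc j) (λ ()))

    d≤0 : ZMatrix M → ∀ i → d i ≤ 0ℚ
    d≤0 offDiag≤0 i = toℚ-mono-≤ (offDiag≤0 (suc i) zero (λ ()))

    qm≤0 : ZMatrix M → 0ℚ < q → ∀ i j → i ≢ j → q * m i j ≤ 0ℚ
    qm≤0 offDiag≤0 q>0 i j i≢j =
      nonNeg*nonPos (ℚ.<⇒≤ q>0) (toℚ-mono-≤ (offDiag≤0 (suc i) (suc j) (λ e → i≢j (Fin.suc-injective e))))

    -cd≤0 : ZMatrix M → ∀ i j → - (c j * d i) ≤ 0ℚ
    -cd≤0 offDiag≤0 i j = ℚ.neg-antimono-≤ (nonPos*nonPos (c≤0 offDiag≤0 j) (d≤0 offDiag≤0 i))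

    zMatrix : ZMatrix M → 0ℚ < q → ZMatrix S
    zMatrix offDiag≤0 q>0 i j i≢j = toℚ-cancel-≤ (subst (_≤ 0ℚ) (sym (entry i j))
      (ℚ.+-mono-≤ (qm≤0 offDiag≤0 q>0 i j i≢j) (-cd≤0 offDiag≤0 i j)))

    zeroPatternSymmetric : ZMatrix M → ZeroPatternSymmetric M → 0ℚ < q → ZeroPatternSymmetric S
    zeroPatternSymmetric offDiag≤0 symmetric q>0 i j Sij≡0 with i Fin.≟ j
    ... | yes refl = Sij≡0
    ... | no i≢j =
      trans (cong₂ (λ x y → M zero zero ℤ.* x ℤ.- y) mji≡0 (product≡0 (ℤ.i*j≡0⇒i≡0∨j≡0 (M zero (suc j)) cd≡0)))
            (cong (ℤ._- 0ℤ) (ℤ.*-zeroʳ (M zero zero)))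
      where
      parts : q * m i j ≡ 0ℚ × - (c j * d i) ≡ 0ℚ
      parts = nonPos+nonPos≡0 (qm≤0 offDiag≤0 q>0 i j i≢j)
        (-cd≤0 offDiag≤0 i j) (trans (sym (entry i j)) (cong toℚ Sij≡0))
      mji≡0 : M (suc j) (suc i) ≡ 0ℤ
      mji≡0 = symmetric (suc i) (suc j)
        (toℚ-injective (*-cancelʳ-pos q>0 (trans (ℚ.*-comm (m i j) q) (proj₁ parts))))
      cd≡0 : M zero (suc j) ℤ.* M (suc i) zero ≡ 0ℤ
      cd≡0 = toℚ-injective (trans (toℚ-* (M zero (suc j)) (M (suc i) zero)) (ℚ.neg-injective (proj₂ parts)))
      product≡0 : M zero (suc j) ≡ 0ℤ ⊎ M (suc i) zero ≡ 0ℤ → M zero (suc i) ℤ.* M (suc j) zero ≡ 0ℤ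
      product≡0 (inj₁ c≡0) = trans (cong (M zero (suc i) ℤ.*_) (symmetric zero (suc j) c≡0)) (ℤ.*-zeroʳ (M zero (suc i)))
      product≡0 (inj₂ d≡0) = trans (cong (ℤ._* M (suc j) zero) (symmetric (suc i) zero d≡0)) (ℤ.*-zeroˡ (M (suc j) zero))

    witness≥ : ZMatrix M → 0ℚ < q → Witness≥ M → Witness≥ S
    witness≥ offDiag≤0 q>0 (u , u>0 , Mu≥0) = u′ , (λ j → u>0 (suc j)) , Su′≥0
      where
      u′ : Vecℚ n
      u′ j = u (suc j)
      Su′≥0 : NonNeg (S · u′)
      Su′≥0 i = subst (0ℚ ≤_)
        (sym (trans (S·≡ (u zero) u′ i) (cong₂ (λ x y → q * x - d i * y) (u-cong (suc i)) (u-cong zero))))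
        (ℚ.+-mono-≤ (nonNeg*nonNeg (ℚ.<⇒≤ q>0) (Mu≥0 (suc i)))
                    (ℚ.neg-antimono-≤ (nonPos*nonNeg (d≤0 offDiag≤0 i) (Mu≥0 zero))))
        where
        u-cong : ∀ k → (M · (u zero ∷ u′)) k ≡ (M · u) k
        u-cong = ·-cong M {u zero ∷ u′} {u} (λ { zero → refl ; (suc j) → refl })

    trivialKernel : 0ℚ < q → TrivialKernel M → TrivialKernel S
    trivialKernel q>0 kernel w Sw≡0 j = kernel v Mv≡0 (suc j)
      where
      a = - sumℚ (λ j → c j * w j) * inverse q q>0
      v = a ∷ w
      Mv₀≡0 : (M · v) zero ≡ 0ℚ
      Mv₀≡0 = begin
        q * (- sumℚ (λ j → c j * w j) * inverse q q>0) + sumℚ (λ j → c j * w j)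
          ≡⟨ solve 3 (λ q s r → q :* (:- s :* r) :+ s := s :* (con 1ℚ :- q :* r)) refl q (sumℚ (λ j → c j * w j)) (inverse q q>0) ⟩
        sumℚ (λ j → c j * w j) * (1ℚ - q * inverse q q>0)
          ≡⟨ cong (λ x → sumℚ (λ j → c j * w j) * (1ℚ - x)) (*-inverse q q>0) ⟩
        sumℚ (λ j → c j * w j) * 0ℚ
          ≡⟨ ℚ.*-zeroʳ (sumℚ (λ j → c j * w j)) ⟩
        0ℚ ∎
      Mv≡0 : IsZero (M · v)
      Mv≡0 zero = Mv₀≡0
      Mv≡0 (suc i) = *-cancelʳ-pos q>0 (begin
        (M · v) (suc i) * q
          ≡⟨ solve 3 (λ x q d → x :* q := q :* x :- d :* con 0ℚ) refl ((M · v) (suc i)) q (d i) ⟩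
        q * (M · v) (suc i) - d i * 0ℚ
          ≡⟨ cong (λ y → q * (M · v) (suc i) - d i * y) (sym Mv₀≡0) ⟩
        q * (M · v) (suc i) - d i * (M · v) zero
          ≡⟨ sym (S·≡ a w i) ⟩
        (S · w) i
          ≡⟨ Sw≡0 i ⟩
        0ℚ ∎)

    -- Choose (M x)₀ = t > 0 small enough that q (M x)ᵢ₊₁ = (S x′)ᵢ + dᵢ t stays positive.
    lift : ZMatrix M → 0ℚ < q → Witness> S → Witness> M
    lift offDiag≤0 q>0 (x′ , x′>0 , Sx′>0) = x , x>0 , Mx>0
      where
      C = sumℚ (λ j → c j * x′ j)
      C≤0 : C ≤ 0ℚ
      C≤0 = sumℚ-nonpos (λ j → nonPos*nonNeg (c≤0 offDiag≤0 j) (ℚ.<⇒≤ (x′>0 j)))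
      T = smallPositive (S · x′) d Sx′>0 (d≤0 offDiag≤0)
      t = proj₁ T
      t>0 = proj₁ (proj₂ T)
      x : Vecℚ (suc n)
      x = (t - C) * inverse q q>0 ∷ x′
      x>0 : Pos x
      x>0 zero = pos*pos (ℚ.+-mono-<-≤ t>0 (ℚ.neg-antimono-≤ C≤0)) (inverse-pos q q>0)
      x>0 (suc j) = x′>0 j
      Mx₀≡t : (M · x) zero ≡ t
      Mx₀≡t = begin
        q * ((t - C) * inverse q q>0) + C
          ≡⟨ solve 4 (λ q t c r → q :* ((t :- c) :* r) :+ c := t :+ (t :- c) :* (q :* r :- con 1ℚ)) refl q t C (inverse q q>0) ⟩
        t + (t - C) * (q * inverse q q>0 - 1ℚ)
          ≡⟨ cong (λ y → t + (t - C) * (y - 1ℚ)) (*-inverse q q>0) ⟩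
        t + (t - C) * (1ℚ - 1ℚ)
          ≡⟨ solve 2 (λ t c → t :+ (t :- c) :* (con 1ℚ :- con 1ℚ) := t) refl t C ⟩
        t ∎
      Mx>0 : Pos (M · x)
      Mx>0 zero = subst (0ℚ <_) (sym Mx₀≡t) t>0
      Mx>0 (suc i) = ℚ.*-cancelˡ-<-nonNeg q {{nonNegative (ℚ.<⇒≤ q>0)}}
        (subst₂ _<_ (sym (ℚ.*-zeroʳ q)) q·Mx (proj₂ (proj₂ T) i))
        where
        q·Mx : (S · x′) i + d i * t ≡ q * (M · x) (suc i)
        q·Mx = begin
          (S · x′) i + d i * t
            ≡⟨ cong (λ y → y + d i * t) (S·≡ ((t - C) * inverse q q>0) x′ i) ⟩
          q * (M · x) (suc i) - d i * (M · x) zero + d i * t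
            ≡⟨ cong (λ y → q * (M · x) (suc i) - d i * y + d i * t) Mx₀≡t ⟩
          q * (M · x) (suc i) - d i * t + d i * t
            ≡⟨ solve 3 (λ a d t → a :- d :* t :+ d :* t := a) refl (q * (M · x) (suc i)) (d i) t ⟩
          q * (M · x) (suc i) ∎

  nonsingular-M-matrix : ∀ {n} (M : Mat n) → ZMatrix M → ZeroPatternSymmetric M → Witness≥ M → TrivialKernel M →
    det M ≢ 0ℤ × Witness> M
  nonsingular-M-matrix {zero} M _ _ _ _ = (λ ()) , (λ ()) , (λ ()) , (λ ())
  nonsingular-M-matrix {suc n} M offDiag≤0 symmetric witness kernel = det≢0 , lift offDiag≤0 q>0 (proj₂ IH)
    where
    open SchurComplement M
    q>0 : 0ℚ < q
    q>0 = pivot-pos M offDiag≤0 symmetric witness kernel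
    IH : det S ≢ 0ℤ × Witness> S
    IH = nonsingular-M-matrix S (zMatrix offDiag≤0 q>0) (zeroPatternSymmetric offDiag≤0 symmetric q>0)
      (witness≥ offDiag≤0 q>0 witness) (trivialKernel q>0 kernel)
    det≢0 : det M ≢ 0ℤ
    det≢0 detM≡0 with ℤ.i*j≡0⇒i≡0∨j≡0 (M zero zero) pdetS≡0
      where
      pdetS≡0 : M zero zero ℤ.* det S ≡ 0ℤ
      pdetS≡0 = trans (chiò-condensation M)
        (trans (cong (M zero zero ℤ.^ n ℤ.*_) detM≡0) (ℤ.*-zeroʳ (M zero zero ℤ.^ n)))
    ... | inj₁ p≡0 = ℚ.<-irrefl (sym (cong toℚ p≡0)) q>0
    ... | inj₂ detS≡0 = proj₁ IH detS≡0

  witness≩⇒trivialKernel : ∀ {n} (A : Mat n) → ZMatrix A → Indecomposable A → Witness≩ A → TrivialKernel A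
  witness≩⇒trivialKernel A offDiag≤0 ind strict v Av≡0 =
    by-cases (witness≩⇒pos⊎zero A offDiag≤0 ind strict v Av≥0)
             (witness≩⇒pos⊎zero A offDiag≤0 ind strict (λ j → - v j) A-v≥0)
    where
    Av≥0 : NonNeg (A · v)
    Av≥0 i = ℚ.≤-reflexive (sym (Av≡0 i))
    A-v≥0 : NonNeg (A · (λ j → - v j))
    A-v≥0 i = ℚ.≤-reflexive (sym (trans (·-neg A v i) (cong -_ (Av≡0 i))))
    by-cases : Pos v ⊎ IsZero v → Pos (λ j → - v j) ⊎ IsZero (λ j → - v j) → IsZero v
    by-cases (inj₂ v≡0) _ = v≡0
    by-cases (inj₁ _) (inj₂ -v≡0) i = ℚ.neg-injective (-v≡0 i)
    by-cases (inj₁ v>0) (inj₁ -v>0) i = ⊥-elim (ℚ.<-asym (-v>0 i) (ℚ.neg-antimono-< (v>0 i)))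

  witness≩⇒finite : ∀ {n} (A : Mat n) → IsSIGCM A → Witness≩ A → IsFinite A
  witness≩⇒finite A sigcm@((_ , offDiag≤0 , symmetric) , _ , ind) strict@(u , u>0 , Au≥0 , _) =
    sigcm , proj₁ nonsingular , proj₂ nonsingular , witness≩⇒pos⊎zero A offDiag≤0 ind strict
    where
    nonsingular : det A ≢ 0ℤ × Witness> A
    nonsingular = nonsingular-M-matrix A offDiag≤0 symmetric (u , u>0 , Au≥0)
      (witness≩⇒trivialKernel A offDiag≤0 ind strict)

open Positivity using (Witness≩; restrict-witness; witness≩⇒finite; finite⇒witness≥; affine⇒witness≥)
open import Data.Nat using (_≤_; _<_; _∸_)
import Data.Rational.Properties as ℚ
open import Relation.Binary.Definitions using (tri<; tri≈; tri>)

TypeN⇒SIGCM : ∀ k {n} {A : Mat n} → TypeN k A → IsSIGCM A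
TypeN⇒SIGCM zero = proj₁
TypeN⇒SIGCM (suc zero) = proj₁
TypeN⇒SIGCM (suc (suc zero)) = proj₁
TypeN⇒SIGCM (suc (suc (suc k))) = proj₁

TypeN⇒indecomposable : ∀ k {n} {A : Mat n} → TypeN k A → Indecomposable A
TypeN⇒indecomposable k tA = proj₂ (proj₂ (TypeN⇒SIGCM k tA))

TypeUpTo⇒TypeN : ∀ k {n} {A : Mat n} → TypeUpTo k A → ∃ λ j → j ≤ k × TypeN j A
TypeUpTo⇒TypeN zero tA = zero , z≤n , tA
TypeUpTo⇒TypeN (suc k) (inj₁ tA) = suc k , ℕ.≤-refl , tA
TypeUpTo⇒TypeN (suc k) (inj₂ tA) with TypeUpTo⇒TypeN k tA
... | j , j≤k , tA′ = j , ℕ.m≤n⇒m≤1+n j≤k , tA′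

finite-empty : (A : Mat 0) → IsSIGCM A → IsFinite A
finite-empty A sigcm = sigcm , (λ ()) , ((λ ()) , (λ ()) , (λ ())) , (λ _ _ → inj₁ (λ ()))

TypeN-suc⇒nonempty : ∀ k {n} {A : Mat n} → TypeN (suc k) A → 1 ≤ n
TypeN-suc⇒nonempty k {suc n} _ = s≤s z≤n
TypeN-suc⇒nonempty zero {zero} (_ , (v , v≢0 , _) , _) = ⊥-elim (v≢0 (λ ()))
TypeN-suc⇒nonempty (suc zero) {zero} {A} (sigcm , ¬finite , _) = ⊥-elim (¬finite (finite-empty A sigcm))
TypeN-suc⇒nonempty (suc (suc k)) {zero} (_ , (m , f , inj , () , _) , _)

witness≩⇒¬TypeN-suc : ∀ k {n} {B : Mat n} → Witness≩ B → ¬ TypeN (suc k) B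
witness≩⇒¬TypeN-suc zero (u , _ , Bu≥0 , Bu≢0) (_ , _ , _ , nonNeg⇒zero) = Bu≢0 (nonNeg⇒zero u Bu≥0)
witness≩⇒¬TypeN-suc (suc zero) {B = B} strict (sigcm , ¬finite , _) = ¬finite (witness≩⇒finite B sigcm strict)
witness≩⇒¬TypeN-suc (suc (suc k)) {B = B} (u , u>0 , Bu≥0 , _) ((gcm , _ , ind) , (m , f , inj , m<n , tD) , _) =
  witness≩⇒¬TypeN-suc (suc k)
    (restrict-witness B (proj₁ (proj₂ gcm)) ind (u , u>0 , Bu≥0) inj (TypeN-suc⇒nonempty (suc k) tD) m<n) tD

proper-sub-type≤ : ∀ k {m n} {A : Mat n} {f : Fin m → Fin n} → TypeN (suc (suc k)) A →
  Injective _≡_ _≡_ f → m < n → Indecomposable (sub A f) → ∃ λ c → c ≤ suc k × TypeN c (sub A f)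
proper-sub-type≤ zero {m} {f = f} (_ , _ , _ , proper-subs) inj m<n indB with proper-subs m f inj m<n indB
... | inj₁ finite = zero , z≤n , finite
... | inj₂ affine = suc zero , ℕ.≤-refl , affine
proper-sub-type≤ (suc k) {m} {f = f} (_ , _ , proper-subs) inj m<n indB =
  TypeUpTo⇒TypeN (suc (suc k)) (proper-subs m f inj m<n indB)

-- Types N₀ and N₁ say nothing directly about submatrices; a restricted witness stands in for them.
proper-sub-witness⊎type< : ∀ c {m n} {A : Mat n} {f : Fin m → Fin n} → TypeN c A →
  Injective _≡_ _≡_ f → m < n → 1 ≤ m → Indecomposable (sub A f) →
  Witness≩ (sub A f) ⊎ ∃ λ c′ → c′ < c × TypeN c′ (sub A f)
proper-sub-witness⊎type< zero {A = A} finite@(((_ , offDiag≤0 , _) , _ , ind) , _) inj m<n 1≤m _ =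
  inj₁ (restrict-witness A offDiag≤0 ind (finite⇒witness≥ finite) inj 1≤m m<n)
proper-sub-witness⊎type< (suc zero) {A = A} affine@(((_ , offDiag≤0 , _) , _ , ind) , _) inj m<n 1≤m _ =
  inj₁ (restrict-witness A offDiag≤0 ind (affine⇒witness≥ affine) inj 1≤m m<n)
proper-sub-witness⊎type< (suc (suc k)) tA inj m<n _ indB with proper-sub-type≤ k tA inj m<n indB
... | c′ , c′≤1+k , tB = inj₂ (c′ , s≤s c′≤1+k , tB)

¬TypeN-< : ∀ a b {n} {A : Mat n} → a < b → TypeN a A → TypeN b A → ⊥
¬TypeN-< zero (suc zero) _ (_ , _ , (x , _ , Ax>0) , _) tA@(_ , _ , _ , nonNeg⇒zero) =
  ℚ.<-irrefl (sym (nonNeg⇒zero x (λ i → ℚ.<⇒≤ (Ax>0 i)) i)) (Ax>0 i)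
  where
  i = Fin.fromℕ< (TypeN-suc⇒nonempty zero tA)
¬TypeN-< (suc a) (suc zero) (s≤s ())
¬TypeN-< zero (suc (suc zero)) _ finite (_ , ¬finite , _) = ¬finite finite
¬TypeN-< (suc zero) (suc (suc zero)) _ affine (_ , _ , ¬affine , _) = ¬affine affine
¬TypeN-< (suc (suc a)) (suc (suc zero)) (s≤s (s≤s ()))
-- The last case eliminates the sum with plain λs: a local helper would hide from the termination
-- checker that b decreases.
¬TypeN-< a (suc (suc (suc b))) a<b tA (_ , (m , f , inj , m<n , tD) , _) =
  [ (λ strict → witness≩⇒¬TypeN-suc (suc b) strict tD)
  , (λ lower → ¬TypeN-< (proj₁ lower) (suc (suc b))
                  (ℕ.<-≤-trans (proj₁ (proj₂ lower)) (ℕ.s≤s⁻¹ a<b)) (proj₂ (proj₂ lower)) tD)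
  ]′ (proper-sub-witness⊎type< a tA inj m<n
       (TypeN-suc⇒nonempty (suc b) tD) (TypeN⇒indecomposable (suc (suc b)) tD))

TypeN-unique : ∀ a b {n} {A : Mat n} → TypeN a A → TypeN b A → a ≡ b
TypeN-unique a b tA tA′ with ℕ.<-cmp a b
... | tri< a<b _ _ = ⊥-elim (¬TypeN-< a b a<b tA tA′)
... | tri≈ _ a≡b _ = a≡b
... | tri> _ _ b<a = ⊥-elim (¬TypeN-< b a b<a tA′ tA)

proper-sub-type< : ∀ c b {m n} {A : Mat n} {f : Fin m → Fin n} → TypeN c A →
  Injective _≡_ _≡_ f → m < n → TypeN (suc b) (sub A f) → suc b < c
proper-sub-type< c b tA inj m<n tB
  with proper-sub-witness⊎type< c tA inj m<n (TypeN-suc⇒nonempty b tB) (TypeN⇒indecomposable (suc b) tB)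
... | inj₁ strict = ⊥-elim (witness≩⇒¬TypeN-suc b strict tB)
... | inj₂ (c′ , c′<c , tB′) = subst (_< c) (TypeN-unique c′ (suc b) tB′ tB) c′<c

intermediate-sub : ∀ k {m n} {A : Mat n} {f : Fin m → Fin n} → TypeN (suc (suc k)) A →
  Injective _≡_ _≡_ f → Indecomposable (sub A f) → 1 ≤ m → suc m < n →
  ∃ λ j → Injective _≡_ _≡_ (j ∷ f) × ∃ λ c → c ≤ suc k × TypeN c (sub A (j ∷ f))
intermediate-sub k {m} {A = A} tA inj indB 1≤m 1+m<n with TypeN⇒SIGCM (suc (suc k)) tA
... | (_ , _ , symmetric) , _ , indA
  with extend-indecomposable A symmetric indA inj indB 1≤m (ℕ.<-trans (ℕ.n<1+n m) 1+m<n)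
...   | j , inj′ , indC = j , inj′ , proper-sub-type≤ k tA inj′ 1+m<n indC

corollary3p2 : (k n : ℕ) → 2 ≤ k → 1 ≤ n → (A : Mat n) → TypeN k A →
    (m : ℕ) (f : Fin m → Fin n) → Injective _≡_ _≡_ f →
    TypeN (k ∸ 1) (sub A f) → n ∸ 1 ≤ m
corollary3p2 (suc zero) _ (s≤s ()) _ _ _ _ _ _ _
corollary3p2 (suc (suc k)) zero _ () _ _ _ _ _ _
corollary3p2 (suc (suc k)) (suc n) _ _ A tA m f inj tB with n ℕ.≤? m
... | yes n≤m = n≤m
... | no n≰m
  with intermediate-sub k tA inj (TypeN⇒indecomposable (suc k) tB) (TypeN-suc⇒nonempty k tB) (s≤s (ℕ.≰⇒> n≰m))
...   | j , _ , c , c≤1+k , tC = ⊥-elim (ℕ.<⇒≱ (proper-sub-type< c k tC Fin.suc-injective (ℕ.n<1+n m) tB) c≤1+k)
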